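{- Let $s\ge2$, $k\ge1$, $1\le r\le s$, and $n,p\ge0$ be integers. The number of words $\pi\in[sk]^n$ with $\overleftarrow{\mathrm{des}}_{R_r}(\pi)=p$, which also equals the number of words $\pi\in[sk]^n$ with $\overleftarrow{\mathrm{ris}}_{R_{s+1-r}}(\pi)=p$, is $$\sum_{j=0}^n\sum_{i_1=0}^j\sum_{i_2=0}^j(-1)^{n+p+i_2}s^{j-i_1}(r-1)^{i_1}\binom{j}{i_1}\binom{j}{i_2}\binom{ki_2}{n-i_1}\binom{n-j}{p}.$$
   Context: $[N]=\{1,\ldots,N\}$ and $[N]^n$ is the set of words of length $n$ over $[N]$. For an integer $c$, $R_c=\{x\in\mathbb{N}: x\equiv c \pmod s\}$. For a word $\pi=\pi_1\cdots\pi_n$ and $X\subseteq\mathbb{N}$, $\overleftarrow{\mathrm{des}}_X(\pi)=|\{i:\pi_i>\pi_{i+1},\ \pi_i\in X\}|$ and $\overleftarrow{\mathrm{ris}}_X(\pi)=|\{i:\pi_i<\pi_{i+1},\ \pi_i\in X\}|$. Conventions: $\binom{a}{b}=0$ if $b<0$ or $b>a$ (for $a\ge0$), and $0^0=1$. -}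

module Defs where

open import Data.Nat using (ℕ; zero; suc; _+_; _*_; _∸_; _^_; _<ᵇ_; _≡ᵇ_)
open import Data.Nat.DivMod using (_%_)
open import Data.Nat.Combinatorics using (_C_)
open import Data.Bool using (Bool; true; false; _∧_; if_then_else_)
open import Data.List using (List; []; _∷_; map; concatMap; length; filterᵇ)
import Data.Integer as ℤ
open ℤ using (ℤ; +_)

range1 : ℕ → List ℕ
range1 zero    = []
range1 (suc N) = range1 N Data.List.++ (suc N ∷ [])

words : ℕ → ℕ → List (List ℕ)
words N zero    = [] ∷ []
words N (suc n) = concatMap (λ a → map (a ∷_) (words N n)) (range1 N)

-- membership in R_c = { x : x ≡ c (mod s) }  (for s = 0: congruence mod 0 is equality)
inR : ℕ → ℕ → ℕ → Bool
inR zero    c x = x ≡ᵇ c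
inR (suc t) c x = (x % suc t) ≡ᵇ (c % suc t)

desR : ℕ → ℕ → List ℕ → ℕ
desR s c []            = 0
desR s c (a ∷ [])      = 0
desR s c (a ∷ b ∷ π)   =
  (if (b <ᵇ a) ∧ inR s c a then 1 else 0) + desR s c (b ∷ π)

risR : ℕ → ℕ → List ℕ → ℕ
risR s c []            = 0
risR s c (a ∷ [])      = 0
risR s c (a ∷ b ∷ π)   =
  (if (a <ᵇ b) ∧ inR s c a then 1 else 0) + risR s c (b ∷ π)

countWords : (List ℕ → ℕ) → ℕ → ℕ → ℕ → ℕ
countWords stat N n p = length (filterᵇ (λ π → stat π ≡ᵇ p) (words N n))

sumTo : ℕ → (ℕ → ℤ) → ℤ
sumTo zero    f = f 0
sumTo (suc m) f = sumTo m f ℤ.+ f (suc m)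

sgn : ℕ → ℤ
sgn e = if e % 2 ≡ᵇ 0 then + 1 else ℤ.- (+ 1)

formula : (s k r n p : ℕ) → ℤ
formula s k r n p =
  sumTo n λ j → sumTo j λ i₁ → sumTo j λ i₂ →
    sgn (n + p + i₂) ℤ.*
    + (s ^ (j ∸ i₁) * (r ∸ 1) ^ i₁ * (j C i₁) * (j C i₂)
        * ((k * i₂) C (n ∸ i₁)) * ((n ∸ j) C p))

{-# OPTIONS --safe #-}
module Submission where

-- Put N = sk and P_n(t) = Σ_{π ∈ [N]^n} t^{des π}. Splitting off the first letter and writing
-- t^{[descent]} = 1 + [descent](t − 1), induction on the first letter gives
--   P_{n+1} = Σ_ℓ (t − 1)^ℓ g_ℓ P_{n−ℓ},
-- where g_ℓ counts the chains a₀ > a₁ > ⋯ > a_ℓ in [N] whose first ℓ letters lie in R_r.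
-- Since [N] consists of k blocks of s consecutive letters, each containing exactly one letter
-- of R_r, counting block by block gives Σ_ℓ g_ℓ z^{ℓ+1} = (s + (r − 1)z)((1 + z)^k − 1) =: G(z).
-- The recurrence is solved by P_n = Σ_j (t − 1)^{n−j} [z^n] G(z)^j, and expanding the three
-- binomials gives the formula. Complementation a ↦ N + 1 − a maps R_{s+1−r} onto R_r and turns
-- ascents into descents, so the ascent count is the same.

open import Defs
open import Data.Bool using (Bool; true; false; _∧_; if_then_else_)
open import Data.Bool.Properties using (∧-comm)
open import Data.Empty using (⊥-elim)
open import Data.Integer as ℤ using (ℤ; +_; -_; -1ℤ)
import Data.Integer.Properties as ℤₚ
open import Algebra.Properties.CommutativeSemigroup ℤₚ.+-commutativeSemigroup
  using () renaming (interchange to +-interchange)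
import Data.Integer.Tactic.RingSolver as ℤ-Solver
open import Data.List using (List; []; _∷_; _++_; map; concatMap; length; filterᵇ)
open import Data.List.Properties using (map-++)
open import Data.List.Relation.Unary.All using (All; []; _∷_)
open import Data.Nat as ℕ
  using (ℕ; zero; suc; _+_; _*_; _∸_; _^_; _≤_; _<_; _≤′_; z≤n; s≤s; _≡ᵇ_; _<ᵇ_; _⊓_; _≤?_; _<?_; _≟_)
open import Data.Nat.Combinatorics using (_C_; k>n⇒nCk≡0; nCk+nC[k+1]≡[n+1]C[k+1]; nC1≡n)
open import Data.Nat.DivMod
  using (_%_; _/_; m<n⇒m%n≡m; n%n≡0; [m+kn]%n≡m%n; m≡m%n+[m/n]*n; m%n<n; m/n*n≤m)
open import Data.Nat.ListAction using (sum)
open import Data.Nat.ListAction.Properties using (sum-++)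
import Data.Nat.Properties as ℕₚ
import Data.Nat.Tactic.RingSolver as ℕ-Solver
open import Data.Product using (_×_; _,_; proj₁; proj₂)
open import Data.Sum using (inj₁; inj₂)
open import Relation.Binary.PropositionalEquality
import Relation.Binary.Reasoning.Setoid as SetoidReasoning
open import Relation.Nullary using (Dec; yes; no)
open import Relation.Nullary.Decidable using (dec-true; dec-false; does-≡; map′)

sumTo-cong : ∀ m {f g : ℕ → ℤ} → (∀ i → i ≤ m → f i ≡ g i) → sumTo m f ≡ sumTo m g
sumTo-cong zero    f≗g = f≗g 0 z≤n
sumTo-cong (suc m) f≗g =
  cong₂ ℤ._+_ (sumTo-cong m (λ i i≤m → f≗g i (ℕₚ.m≤n⇒m≤1+n i≤m))) (f≗g (suc m) ℕₚ.≤-refl)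

sumTo-+ : ∀ m (f g : ℕ → ℤ) → sumTo m (λ i → f i ℤ.+ g i) ≡ sumTo m f ℤ.+ sumTo m g
sumTo-+ zero    f g = refl
sumTo-+ (suc m) f g =
  trans (cong (ℤ._+ (f (suc m) ℤ.+ g (suc m))) (sumTo-+ m f g)) (+-interchange (sumTo m f) (sumTo m g) (f (suc m)) (g (suc m)))

*-distribˡ-sumTo : ∀ m c (f : ℕ → ℤ) → c ℤ.* sumTo m f ≡ sumTo m (λ i → c ℤ.* f i)
*-distribˡ-sumTo zero    c f = refl
*-distribˡ-sumTo (suc m) c f =
  trans (ℤₚ.*-distribˡ-+ c (sumTo m f) (f (suc m))) (cong (ℤ._+ c ℤ.* f (suc m)) (*-distribˡ-sumTo m c f))

*-distribʳ-sumTo : ∀ m c (f : ℕ → ℤ) → sumTo m f ℤ.* c ≡ sumTo m (λ i → f i ℤ.* c)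
*-distribʳ-sumTo m c f = begin
  sumTo m f ℤ.* c              ≡⟨ ℤₚ.*-comm (sumTo m f) c ⟩
  c ℤ.* sumTo m f              ≡⟨ *-distribˡ-sumTo m c f ⟩
  sumTo m (λ i → c ℤ.* f i)    ≡⟨ sumTo-cong m (λ i _ → ℤₚ.*-comm c (f i)) ⟩
  sumTo m (λ i → f i ℤ.* c)    ∎
  where open ≡-Reasoning

neg-distrib-sumTo : ∀ m (f : ℕ → ℤ) → - sumTo m f ≡ sumTo m (λ i → - f i)
neg-distrib-sumTo m f = begin
  - sumTo m f                  ≡⟨ ℤₚ.-1*i≡-i (sumTo m f) ⟨
  -1ℤ ℤ.* sumTo m f            ≡⟨ *-distribˡ-sumTo m -1ℤ f ⟩
  sumTo m (λ i → -1ℤ ℤ.* f i)  ≡⟨ sumTo-cong m (λ i _ → ℤₚ.-1*i≡-i (f i)) ⟩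
  sumTo m (λ i → - f i)        ∎
  where open ≡-Reasoning

sumTo-suc : ∀ m (f : ℕ → ℤ) → sumTo (suc m) f ≡ f 0 ℤ.+ sumTo m (λ i → f (suc i))
sumTo-suc zero    f = refl
sumTo-suc (suc m) f =
  trans (cong (ℤ._+ f (suc (suc m))) (sumTo-suc m f)) (ℤₚ.+-assoc (f 0) _ _)

sumTo-≡0 : ∀ m {f : ℕ → ℤ} → (∀ i → i ≤ m → f i ≡ + 0) → sumTo m f ≡ + 0
sumTo-≡0 zero    f≡0 = f≡0 0 z≤n
sumTo-≡0 (suc m) f≡0 =
  cong₂ ℤ._+_ (sumTo-≡0 m (λ i i≤m → f≡0 i (ℕₚ.m≤n⇒m≤1+n i≤m))) (f≡0 (suc m) ℕₚ.≤-refl)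

sumTo-extend : ∀ {m m'} (f : ℕ → ℤ) → m ≤ m' → (∀ i → m < i → f i ≡ + 0) → sumTo m' f ≡ sumTo m f
sumTo-extend {m} f m≤m' vanish = extend (ℕₚ.≤⇒≤′ m≤m')
  where
  open ≡-Reasoning
  extend : ∀ {m'} → m ≤′ m' → sumTo m' f ≡ sumTo m f
  extend ℕ.≤′-refl = refl
  extend {suc m'} (ℕ.≤′-step m≤′m') = begin
    sumTo m' f ℤ.+ f (suc m') ≡⟨ cong₂ ℤ._+_ (extend m≤′m') (vanish (suc m') (s≤s (ℕₚ.≤′⇒≤ m≤′m'))) ⟩
    sumTo m f ℤ.+ + 0         ≡⟨ ℤₚ.+-identityʳ (sumTo m f) ⟩
    sumTo m f                 ∎

sumTo-swap : ∀ m n (f : ℕ → ℕ → ℤ) →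
  sumTo m (λ i → sumTo n (λ j → f i j)) ≡ sumTo n (λ j → sumTo m (λ i → f i j))
sumTo-swap zero    n f = refl
sumTo-swap (suc m) n f =
  trans (cong (ℤ._+ sumTo n (f (suc m))) (sumTo-swap m n f)) (sym (sumTo-+ n _ _))

sumTo-reverse : ∀ m (f : ℕ → ℤ) → sumTo m f ≡ sumTo m (λ i → f (m ∸ i))
sumTo-reverse zero    f = refl
sumTo-reverse (suc m) f = begin
  sumTo m f ℤ.+ f (suc m)                        ≡⟨ cong (ℤ._+ f (suc m)) (sumTo-reverse m f) ⟩
  sumTo m (λ i → f (m ∸ i)) ℤ.+ f (suc m)        ≡⟨ ℤₚ.+-comm _ (f (suc m)) ⟩
  f (suc m) ℤ.+ sumTo m (λ i → f (m ∸ i))        ≡⟨ sumTo-suc m (λ i → f (suc m ∸ i)) ⟨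
  sumTo (suc m) (λ i → f (suc m ∸ i))            ∎
  where open ≡-Reasoning

sumTo-triangle : ∀ n (F : ℕ → ℕ → ℤ) →
  sumTo n (λ i → sumTo i (λ a → F a i)) ≡ sumTo n (λ a → sumTo (n ∸ a) (λ b → F a (a + b)))
sumTo-triangle zero    F = refl
sumTo-triangle (suc n) F = begin
  sumTo (suc n) (λ i → sumTo i (λ a → F a i))
    ≡⟨ sumTo-suc n _ ⟩
  F 0 0 ℤ.+ sumTo n (λ i → sumTo (suc i) (λ a → F a (suc i)))
    ≡⟨ cong (ℤ._+_ (F 0 0)) (trans (sumTo-cong n (λ i _ → sumTo-suc i _)) (sumTo-+ n _ _)) ⟩
  F 0 0 ℤ.+ (sumTo n (λ i → F 0 (suc i)) ℤ.+ sumTo n (λ i → sumTo i (λ a → F (suc a) (suc i))))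
    ≡⟨ ℤₚ.+-assoc (F 0 0) _ _ ⟨
  (F 0 0 ℤ.+ sumTo n (λ i → F 0 (suc i))) ℤ.+ sumTo n (λ i → sumTo i (λ a → F (suc a) (suc i)))
    ≡⟨ cong₂ ℤ._+_ (sym (sumTo-suc n (F 0))) (sumTo-triangle n (λ a i → F (suc a) (suc i))) ⟩
  sumTo (suc n) (F 0) ℤ.+ sumTo n (λ a → sumTo (n ∸ a) (λ b → F (suc a) (suc (a + b))))
    ≡⟨ sumTo-suc n _ ⟨
  sumTo (suc n) (λ a → sumTo (suc n ∸ a) (λ b → F a (a + b)))
    ∎
  where open ≡-Reasoning

-- Coefficient sequences; they serve both as power series in z and as polynomials in t.
Series : Set
Series = ℕ → ℤ

module ≗-Reasoning = SetoidReasoning (ℕ →-setoid ℤ)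

infixl 6 _⊕_
infixl 7 _⊛_
infixr 7.5 _∙_

_⊕_ : Series → Series → Series
(f ⊕ g) n = f n ℤ.+ g n

⊝_ : Series → Series
(⊝ f) n = - f n

_∙_ : ℤ → Series → Series
(c ∙ f) n = c ℤ.* f n

𝟘 : Series
𝟘 _ = + 0

𝟙 : Series
𝟙 zero    = + 1
𝟙 (suc n) = + 0

shift : Series → Series
shift f zero    = + 0
shift f (suc n) = f n

_⊛_ : Series → Series → Series
(f ⊛ g) n = sumTo n (λ i → f i ℤ.* g (n ∸ i))

pow : Series → ℕ → Series
pow f zero    = 𝟙
pow f (suc j) = f ⊛ pow f j

sumToₛ : ℕ → (ℕ → Series) → Series
sumToₛ m F n = sumTo m (λ i → F i n)

shift-cong : ∀ {f g} → f ≗ g → shift f ≗ shift g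
shift-cong f≗g zero    = refl
shift-cong f≗g (suc n) = f≗g n

⊛-cong : ∀ {f f′ g g′} → f ≗ f′ → g ≗ g′ → f ⊛ g ≗ f′ ⊛ g′
⊛-cong f≗f′ g≗g′ n = sumTo-cong n (λ i _ → cong₂ ℤ._*_ (f≗f′ i) (g≗g′ (n ∸ i)))

⊛-congˡ : ∀ f {g g′} → g ≗ g′ → f ⊛ g ≗ f ⊛ g′
⊛-congˡ f g≗g′ = ⊛-cong {f} {f} (λ _ → refl) g≗g′

⊛-congʳ : ∀ {f f′} g → f ≗ f′ → f ⊛ g ≗ f′ ⊛ g
⊛-congʳ g f≗f′ = ⊛-cong {g = g} {g′ = g} f≗f′ (λ _ → refl)

⊕-congˡ : ∀ f {g g′} → g ≗ g′ → f ⊕ g ≗ f ⊕ g′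
⊕-congˡ f g≗g′ n = cong (ℤ._+_ (f n)) (g≗g′ n)

sumToₛ-cong : ∀ m {F G : ℕ → Series} → (∀ i → i ≤ m → F i ≗ G i) → sumToₛ m F ≗ sumToₛ m G
sumToₛ-cong m F≗G n = sumTo-cong m (λ i i≤m → F≗G i i≤m n)

⊛-comm : ∀ f g → f ⊛ g ≗ g ⊛ f
⊛-comm f g n = begin
  sumTo n (λ i → f i ℤ.* g (n ∸ i))               ≡⟨ sumTo-reverse n _ ⟩
  sumTo n (λ i → f (n ∸ i) ℤ.* g (n ∸ (n ∸ i)))   ≡⟨ sumTo-cong n swap ⟩
  sumTo n (λ i → g i ℤ.* f (n ∸ i))               ∎
  where
  open ≡-Reasoning
  swap : ∀ i → i ≤ n → f (n ∸ i) ℤ.* g (n ∸ (n ∸ i)) ≡ g i ℤ.* f (n ∸ i)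
  swap i i≤n = trans (cong (λ m → f (n ∸ i) ℤ.* g m) (ℕₚ.m∸[m∸n]≡n i≤n)) (ℤₚ.*-comm (f (n ∸ i)) (g i))

⊛-assoc : ∀ f g h → (f ⊛ g) ⊛ h ≗ f ⊛ (g ⊛ h)
⊛-assoc f g h n = begin
  sumTo n (λ i → sumTo i (λ a → f a ℤ.* g (i ∸ a)) ℤ.* h (n ∸ i))
    ≡⟨ sumTo-cong n (λ i _ → *-distribʳ-sumTo i (h (n ∸ i)) _) ⟩
  sumTo n (λ i → sumTo i (λ a → f a ℤ.* g (i ∸ a) ℤ.* h (n ∸ i)))
    ≡⟨ sumTo-triangle n (λ a i → f a ℤ.* g (i ∸ a) ℤ.* h (n ∸ i)) ⟩
  sumTo n (λ a → sumTo (n ∸ a) (λ b → f a ℤ.* g (a + b ∸ a) ℤ.* h (n ∸ (a + b))))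
    ≡⟨ sumTo-cong n (λ a _ → sumTo-cong (n ∸ a) (λ b _ → reindex a b)) ⟩
  sumTo n (λ a → sumTo (n ∸ a) (λ b → f a ℤ.* (g b ℤ.* h (n ∸ a ∸ b))))
    ≡⟨ sumTo-cong n (λ a _ → *-distribˡ-sumTo (n ∸ a) (f a) _) ⟨
  sumTo n (λ a → f a ℤ.* sumTo (n ∸ a) (λ b → g b ℤ.* h (n ∸ a ∸ b)))
    ∎
  where
  open ≡-Reasoning
  reindex : ∀ a b → f a ℤ.* g (a + b ∸ a) ℤ.* h (n ∸ (a + b)) ≡ f a ℤ.* (g b ℤ.* h (n ∸ a ∸ b))
  reindex a b = trans (cong₂ (λ x y → f a ℤ.* g x ℤ.* h y) (ℕₚ.m+n∸m≡n a b) (sym (ℕₚ.∸-+-assoc n a b)))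
                      (ℤₚ.*-assoc (f a) (g b) _)

⊛-distribʳ-⊕ : ∀ f g h → (f ⊕ g) ⊛ h ≗ f ⊛ h ⊕ g ⊛ h
⊛-distribʳ-⊕ f g h n =
  trans (sumTo-cong n (λ i _ → ℤₚ.*-distribʳ-+ (h (n ∸ i)) (f i) (g i))) (sumTo-+ n _ _)

∙-⊛ : ∀ c f g → c ∙ f ⊛ g ≗ c ∙ (f ⊛ g)
∙-⊛ c f g n =
  trans (sumTo-cong n (λ i _ → ℤₚ.*-assoc c (f i) (g (n ∸ i)))) (sym (*-distribˡ-sumTo n c _))

⊛-∙ : ∀ c f g → f ⊛ c ∙ g ≗ c ∙ (f ⊛ g)
⊛-∙ c f g = begin
  f ⊛ c ∙ g    ≈⟨ ⊛-comm f (c ∙ g) ⟩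
  c ∙ g ⊛ f    ≈⟨ ∙-⊛ c g f ⟩
  c ∙ (g ⊛ f)  ≈⟨ (λ n → cong (c ℤ.*_) (⊛-comm g f n)) ⟩
  c ∙ (f ⊛ g)  ∎
  where open ≗-Reasoning

⊛-sumToₛ : ∀ m f (F : ℕ → Series) → f ⊛ sumToₛ m F ≗ sumToₛ m (λ i → f ⊛ F i)
⊛-sumToₛ m f F n =
  trans (sumTo-cong n (λ a _ → *-distribˡ-sumTo m (f a) _)) (sumTo-swap n m _)

𝟙-⊛ : ∀ f → 𝟙 ⊛ f ≗ f
𝟙-⊛ f zero    = ℤₚ.*-identityˡ (f 0)
𝟙-⊛ f (suc n) = begin
  sumTo (suc n) (λ i → 𝟙 i ℤ.* f (suc n ∸ i))   ≡⟨ sumTo-suc n _ ⟩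
  + 1 ℤ.* f (suc n) ℤ.+ sumTo n (λ _ → + 0)     ≡⟨ cong₂ ℤ._+_ (ℤₚ.*-identityˡ (f (suc n)))
                                                               (sumTo-≡0 n (λ _ _ → refl)) ⟩
  f (suc n) ℤ.+ + 0                             ≡⟨ ℤₚ.+-identityʳ (f (suc n)) ⟩
  f (suc n)                                     ∎
  where open ≡-Reasoning

shift-⊛ : ∀ f g → shift f ⊛ g ≗ shift (f ⊛ g)
shift-⊛ f g zero    = refl
shift-⊛ f g (suc n) = trans (sumTo-suc n _) (ℤₚ.+-identityˡ _)

⊛-interchange : ∀ a b c d → (a ⊛ b) ⊛ (c ⊛ d) ≗ (a ⊛ c) ⊛ (b ⊛ d)
⊛-interchange a b c d = begin
  (a ⊛ b) ⊛ (c ⊛ d)  ≈⟨ ⊛-assoc a b (c ⊛ d) ⟩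
  a ⊛ (b ⊛ (c ⊛ d))  ≈⟨ ⊛-congˡ a (⊛-assoc b c d) ⟨
  a ⊛ ((b ⊛ c) ⊛ d)  ≈⟨ ⊛-congˡ a (⊛-congʳ d (⊛-comm b c)) ⟩
  a ⊛ ((c ⊛ b) ⊛ d)  ≈⟨ ⊛-congˡ a (⊛-assoc c b d) ⟩
  a ⊛ (c ⊛ (b ⊛ d))  ≈⟨ ⊛-assoc a c (b ⊛ d) ⟨
  (a ⊛ c) ⊛ (b ⊛ d)  ∎
  where open ≗-Reasoning

pow-+ : ∀ f a b → pow f (a + b) ≗ pow f a ⊛ pow f b
pow-+ f zero    b = λ n → sym (𝟙-⊛ (pow f b) n)
pow-+ f (suc a) b = begin
  f ⊛ pow f (a + b)        ≈⟨ ⊛-congˡ f (pow-+ f a b) ⟩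
  f ⊛ (pow f a ⊛ pow f b)  ≈⟨ ⊛-assoc f (pow f a) (pow f b) ⟨
  f ⊛ pow f a ⊛ pow f b    ∎
  where open ≗-Reasoning

pow-* : ∀ f a b → pow f (a * b) ≗ pow (pow f a) b
pow-* f a zero    n = cong (λ m → pow f m n) (ℕₚ.*-zeroʳ a)
pow-* f a (suc b) = begin
  pow f (a * suc b)            ≈⟨ (λ n → cong (λ m → pow f m n) (ℕₚ.*-suc a b)) ⟩
  pow f (a + a * b)            ≈⟨ pow-+ f a (a * b) ⟩
  pow f a ⊛ pow f (a * b)      ≈⟨ ⊛-congˡ (pow f a) (pow-* f a b) ⟩
  pow f a ⊛ pow (pow f a) b    ∎
  where open ≗-Reasoning

pow-⊛ : ∀ f g j → pow (f ⊛ g) j ≗ pow f j ⊛ pow g j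
pow-⊛ f g zero    = λ n → sym (𝟙-⊛ 𝟙 n)
pow-⊛ f g (suc j) = begin
  f ⊛ g ⊛ pow (f ⊛ g) j          ≈⟨ ⊛-congˡ (f ⊛ g) (pow-⊛ f g j) ⟩
  f ⊛ g ⊛ (pow f j ⊛ pow g j)    ≈⟨ ⊛-interchange f g (pow f j) (pow g j) ⟩
  f ⊛ pow f j ⊛ (g ⊛ pow g j)    ∎
  where open ≗-Reasoning

pow-cong : ∀ {f g} j → f ≗ g → pow f j ≗ pow g j
pow-cong zero    f≗g = λ _ → refl
pow-cong (suc j) f≗g = ⊛-cong f≗g (pow-cong j f≗g)

z : Series
z = shift 𝟙

z-⊛ : ∀ f → z ⊛ f ≗ shift f
z-⊛ f n = trans (shift-⊛ 𝟙 f n) (shift-cong (𝟙-⊛ f) n)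

linear : ℕ → ℕ → Series
linear a b = + a ∙ 𝟙 ⊕ + b ∙ z

linear-⊛ : ∀ a b f → linear a b ⊛ f ≗ + a ∙ f ⊕ + b ∙ shift f
linear-⊛ a b f n = trans (⊛-distribʳ-⊕ (+ a ∙ 𝟙) (+ b ∙ z) f n) (cong₂ ℤ._+_
  (trans (∙-⊛ (+ a) 𝟙 f n) (cong (ℤ._*_ (+ a)) (𝟙-⊛ f n)))
  (trans (∙-⊛ (+ b) z f n) (cong (ℤ._*_ (+ b)) (z-⊛ f n))))

-- If i ≥ j the binomial factor vanishes, so the truncated exponent j ∸ suc i is harmless.
^∸suc-*-C : ∀ a j i → a * a ^ (j ∸ suc i) * (j C suc i) ≡ a ^ (j ∸ i) * (j C suc i)
^∸suc-*-C a j i with suc i ≤? j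
... | yes i<j = cong (λ e → a ^ e * (j C suc i)) (sym (ℕₚ.+-∸-assoc 1 i<j))
... | no  i≮j rewrite k>n⇒nCk≡0 (ℕₚ.≰⇒> i≮j) =
  trans (ℕₚ.*-zeroʳ (a * a ^ (j ∸ suc i))) (sym (ℕₚ.*-zeroʳ (a ^ (j ∸ i))))

binomial-pascal : ∀ a b j i →
  a * (a ^ (j ∸ suc i) * b ^ suc i * (j C suc i)) + b * (a ^ (j ∸ i) * b ^ i * (j C i))
  ≡ a ^ (suc j ∸ suc i) * b ^ suc i * (suc j C suc i)
binomial-pascal a b j i = begin
  a * (A′ * (b * B) * C₁) + b * (A * B * C₀)  ≡⟨ regroup a A′ b B C₁ A C₀ ⟩
  a * A′ * C₁ * (b * B) + A * (b * B) * C₀    ≡⟨ cong (λ x → x * (b * B) + A * (b * B) * C₀) (^∸suc-*-C a j i) ⟩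
  A * C₁ * (b * B) + A * (b * B) * C₀         ≡⟨ collect A C₁ (b * B) C₀ ⟩
  A * (b * B) * (C₀ + C₁)                     ≡⟨ cong (A * (b * B) *_) (nCk+nC[k+1]≡[n+1]C[k+1] j i) ⟩
  A * (b * B) * (suc j C suc i)               ∎
  where
  open ≡-Reasoning
  A′ = a ^ (j ∸ suc i)
  A  = a ^ (j ∸ i)
  B  = b ^ i
  C₀ = j C i
  C₁ = j C suc i
  regroup : ∀ a A′ b B C₁ A C₀ →
    a * (A′ * (b * B) * C₁) + b * (A * B * C₀) ≡ a * A′ * C₁ * (b * B) + A * (b * B) * C₀
  regroup = ℕ-Solver.solve-∀
  collect : ∀ A C₁ bB C₀ → A * C₁ * bB + A * bB * C₀ ≡ A * bB * (C₀ + C₁)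
  collect = ℕ-Solver.solve-∀

pow-linear : ∀ a b j i → pow (linear a b) j i ≡ + (a ^ (j ∸ i) * b ^ i * (j C i))
pow-linear a b zero    zero    = refl
pow-linear a b zero    (suc i) = cong +_ (sym (ℕₚ.*-zeroʳ (1 * b ^ suc i)))
pow-linear a b (suc j) zero    = begin
  pow (linear a b) (suc j) 0                     ≡⟨ linear-⊛ a b (pow (linear a b) j) 0 ⟩
  + a ℤ.* pow (linear a b) j 0 ℤ.+ + b ℤ.* + 0   ≡⟨ cong₂ ℤ._+_ (cong (ℤ._*_ (+ a)) (pow-linear a b j 0))
                                                                (ℤₚ.*-zeroʳ (+ b)) ⟩
  + a ℤ.* + (a ^ j * 1 * 1) ℤ.+ + 0              ≡⟨ ℤₚ.+-identityʳ _ ⟩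
  + a ℤ.* + (a ^ j * 1 * 1)                      ≡⟨ ℤₚ.pos-* a _ ⟨
  + (a * (a ^ j * 1 * 1))                        ≡⟨ cong +_ (trans (cong (_* 1) (ℕₚ.*-assoc a (a ^ j) 1))
                                                                   (ℕₚ.*-assoc a (a ^ j * 1) 1)) ⟨
  + (a ^ suc j * 1 * 1)                          ∎
  where open ≡-Reasoning
pow-linear a b (suc j) (suc i) = begin
  pow (linear a b) (suc j) (suc i)
    ≡⟨ linear-⊛ a b (pow (linear a b) j) (suc i) ⟩
  + a ℤ.* pow (linear a b) j (suc i) ℤ.+ + b ℤ.* pow (linear a b) j i
    ≡⟨ cong₂ (λ x y → + a ℤ.* x ℤ.+ + b ℤ.* y) (pow-linear a b j (suc i)) (pow-linear a b j i) ⟩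
  + a ℤ.* + (a ^ (j ∸ suc i) * b ^ suc i * (j C suc i)) ℤ.+ + b ℤ.* + (a ^ (j ∸ i) * b ^ i * (j C i))
    ≡⟨ cong₂ ℤ._+_ (ℤₚ.pos-* a _) (ℤₚ.pos-* b _) ⟨
  + (a * (a ^ (j ∸ suc i) * b ^ suc i * (j C suc i))) ℤ.+ + (b * (a ^ (j ∸ i) * b ^ i * (j C i)))
    ≡⟨ cong +_ (binomial-pascal a b j i) ⟩
  + (a ^ (suc j ∸ suc i) * b ^ suc i * (suc j C suc i))
    ∎
  where open ≡-Reasoning

pow-1+z : ∀ M m → pow (linear 1 1) M m ≡ + (M C m)
pow-1+z M m = trans (pow-linear 1 1 M m) (cong +_ (begin
  1 ^ (M ∸ m) * 1 ^ m * (M C m)  ≡⟨ cong₂ (λ x y → x * y * (M C m)) (ℕₚ.^-zeroˡ (M ∸ m)) (ℕₚ.^-zeroˡ m) ⟩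
  1 * 1 * (M C m)                ≡⟨ ℕₚ.*-identityˡ (M C m) ⟩
  M C m                          ∎))
  where open ≡-Reasoning

signedBinom : ℕ → ℕ → ℤ
signedBinom j i = -1ℤ ℤ.^ (j + i) ℤ.* + (j C i)

-1^-suc : ∀ n → -1ℤ ℤ.^ suc n ≡ - (-1ℤ ℤ.^ n)
-1^-suc n = ℤₚ.-1*i≡-i (-1ℤ ℤ.^ n)

-1^-suc-suc : ∀ n → -1ℤ ℤ.^ suc (suc n) ≡ -1ℤ ℤ.^ n
-1^-suc-suc n = trans (-1^-suc (suc n)) (trans (cong -_ (-1^-suc n)) (ℤₚ.neg-involutive _))

signedBinom-suc-zero : ∀ j → signedBinom (suc j) 0 ≡ - signedBinom j 0
signedBinom-suc-zero j =
  trans (cong (ℤ._* + 1) (-1^-suc (j + 0))) (sym (ℤₚ.neg-distribˡ-* (-1ℤ ℤ.^ (j + 0)) (+ 1)))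

signedBinom-suc-diag : ∀ j → signedBinom j (suc j) ≡ + 0
signedBinom-suc-diag j =
  trans (cong (λ c → -1ℤ ℤ.^ (j + suc j) ℤ.* + c) (k>n⇒nCk≡0 (ℕₚ.n<1+n j))) (ℤₚ.*-zeroʳ (-1ℤ ℤ.^ (j + suc j)))

signedBinom-pascal : ∀ j i → signedBinom (suc j) (suc i) ≡ signedBinom j i ℤ.+ - signedBinom j (suc i)
signedBinom-pascal j i = begin
  -1ℤ ℤ.^ (suc j + suc i) ℤ.* + (suc j C suc i)
    ≡⟨ cong₂ ℤ._*_ (trans (cong (λ e → -1ℤ ℤ.^ suc e) (ℕₚ.+-suc j i)) (-1^-suc-suc (j + i)))
                   (cong +_ (sym (nCk+nC[k+1]≡[n+1]C[k+1] j i))) ⟩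
  σ ℤ.* + (j C i + j C suc i)
    ≡⟨ cong (σ ℤ.*_) (ℤₚ.pos-+ (j C i) (j C suc i)) ⟩
  σ ℤ.* (+ (j C i) ℤ.+ + (j C suc i))
    ≡⟨ split σ (+ (j C i)) (+ (j C suc i)) ⟩
  σ ℤ.* + (j C i) ℤ.+ - (- σ ℤ.* + (j C suc i))
    ≡⟨ cong (λ x → σ ℤ.* + (j C i) ℤ.+ - (x ℤ.* + (j C suc i))) σ′≡-σ ⟨
  signedBinom j i ℤ.+ - signedBinom j (suc i)
    ∎
  where
  open ≡-Reasoning
  σ = -1ℤ ℤ.^ (j + i)
  σ′≡-σ : -1ℤ ℤ.^ (j + suc i) ≡ - σ
  σ′≡-σ = trans (cong (-1ℤ ℤ.^_) (ℕₚ.+-suc j i)) (-1^-suc (j + i))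
  split : ∀ σ a b → σ ℤ.* (a ℤ.+ b) ≡ σ ℤ.* a ℤ.+ - (- σ ℤ.* b)
  split = ℤ-Solver.solve-∀

signedBinom-pascal-sum : ∀ j (w : ℕ → ℤ) →
  sumTo j (λ i → signedBinom j i ℤ.* w (suc i)) ℤ.+ - sumTo j (λ i → signedBinom j i ℤ.* w i)
  ≡ sumTo (suc j) (λ i → signedBinom (suc j) i ℤ.* w i)
signedBinom-pascal-sum j w = sym (begin
  sumTo (suc j) (λ i → signedBinom (suc j) i ℤ.* w i)
    ≡⟨ sumTo-suc j _ ⟩
  signedBinom (suc j) 0 ℤ.* w 0 ℤ.+ sumTo j (λ i → signedBinom (suc j) (suc i) ℤ.* w (suc i))
    ≡⟨ cong₂ ℤ._+_ (cong (ℤ._* w 0) (signedBinom-suc-zero j)) (sumTo-cong j (λ i _ → expand i)) ⟩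
  - c 0 ℤ.* w 0 ℤ.+ sumTo j (λ i → c i ℤ.* w (suc i) ℤ.+ - (c (suc i) ℤ.* w (suc i)))
    ≡⟨ cong (ℤ._+_ (- c 0 ℤ.* w 0)) (trans (sumTo-+ j _ _) (cong (ℤ._+_ X) (sym (neg-distrib-sumTo j _)))) ⟩
  - c 0 ℤ.* w 0 ℤ.+ (X ℤ.+ - Z)
    ≡⟨ rearrange (c 0) (w 0) X Z ⟩
  X ℤ.+ - (c 0 ℤ.* w 0 ℤ.+ Z)
    ≡⟨ cong (λ y → X ℤ.+ - y) Y≡ ⟨
  X ℤ.+ - Y
    ∎)
  where
  open ≡-Reasoning
  c = signedBinom j
  X = sumTo j (λ i → c i ℤ.* w (suc i))
  Y = sumTo j (λ i → c i ℤ.* w i)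
  Z = sumTo j (λ i → c (suc i) ℤ.* w (suc i))
  expand : ∀ i → signedBinom (suc j) (suc i) ℤ.* w (suc i) ≡ c i ℤ.* w (suc i) ℤ.+ - (c (suc i) ℤ.* w (suc i))
  expand i = trans (cong (ℤ._* w (suc i)) (signedBinom-pascal j i))
    (trans (ℤₚ.*-distribʳ-+ (w (suc i)) (c i) (- c (suc i)))
           (cong (ℤ._+_ (c i ℤ.* w (suc i))) (sym (ℤₚ.neg-distribˡ-* (c (suc i)) (w (suc i))))))
  rearrange : ∀ c w X Z → - c ℤ.* w ℤ.+ (X ℤ.+ - Z) ≡ X ℤ.+ - (c ℤ.* w ℤ.+ Z)
  rearrange = ℤ-Solver.solve-∀
  Y≡ : Y ≡ c 0 ℤ.* w 0 ℤ.+ Z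
  Y≡ = begin
    Y                                       ≡⟨ ℤₚ.+-identityʳ Y ⟨
    Y ℤ.+ + 0                               ≡⟨ cong (ℤ._+_ Y) (trans (cong (ℤ._* w (suc j)) (signedBinom-suc-diag j))
                                                                     (ℤₚ.*-zeroˡ (w (suc j)))) ⟨
    sumTo (suc j) (λ i → c i ℤ.* w i)       ≡⟨ sumTo-suc j _ ⟩
    c 0 ℤ.* w 0 ℤ.+ Z                       ∎

⊝𝟙-⊛ : ∀ f → (⊝ 𝟙) ⊛ f ≗ ⊝ f
⊝𝟙-⊛ f n = begin
  ((⊝ 𝟙) ⊛ f) n     ≡⟨ ⊛-congʳ f (λ m → sym (ℤₚ.-1*i≡-i (𝟙 m))) n ⟩
  (-1ℤ ∙ 𝟙 ⊛ f) n   ≡⟨ ∙-⊛ -1ℤ 𝟙 f n ⟩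
  -1ℤ ℤ.* (𝟙 ⊛ f) n ≡⟨ ℤₚ.-1*i≡-i _ ⟩
  - (𝟙 ⊛ f) n       ≡⟨ cong -_ (𝟙-⊛ f n) ⟩
  - f n             ∎
  where open ≡-Reasoning

pow-⊝𝟙 : ∀ f j → pow (f ⊕ ⊝ 𝟙) j ≗ sumToₛ j (λ i → signedBinom j i ∙ pow f i)
pow-⊝𝟙 f zero    n = sym (ℤₚ.*-identityˡ (𝟙 n))
pow-⊝𝟙 f (suc j) n = begin
  ((f ⊕ ⊝ 𝟙) ⊛ pow (f ⊕ ⊝ 𝟙) j) n
    ≡⟨ ⊛-congˡ (f ⊕ ⊝ 𝟙) (pow-⊝𝟙 f j) n ⟩
  ((f ⊕ ⊝ 𝟙) ⊛ E) n
    ≡⟨ ⊛-distribʳ-⊕ f (⊝ 𝟙) E n ⟩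
  (f ⊛ E) n ℤ.+ ((⊝ 𝟙) ⊛ E) n
    ≡⟨ cong₂ ℤ._+_ (trans (⊛-sumToₛ j f (λ i → signedBinom j i ∙ pow f i) n)
                          (sumTo-cong j (λ i _ → ⊛-∙ (signedBinom j i) f (pow f i) n)))
                   (⊝𝟙-⊛ E n) ⟩
  sumTo j (λ i → signedBinom j i ℤ.* pow f (suc i) n) ℤ.+ - E n
    ≡⟨ signedBinom-pascal-sum j (λ i → pow f i n) ⟩
  sumTo (suc j) (λ i → signedBinom (suc j) i ℤ.* pow f i n)
    ∎
  where
  open ≡-Reasoning
  E = sumToₛ j (λ i → signedBinom j i ∙ pow f i)

binomialMinusOne : ℕ → Series
binomialMinusOne k = pow (linear 1 1) k ⊕ ⊝ 𝟙

binomialMinusOne-zero : ∀ k → binomialMinusOne k 0 ≡ + 0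
binomialMinusOne-zero k = cong (ℤ._+ -1ℤ) (pow-1+z k 0)

binomialMinusOne-suc : ∀ k m → binomialMinusOne k (suc m) ≡ + (k C suc m)
binomialMinusOne-suc k m = trans (cong (ℤ._+ + 0) (pow-1+z k (suc m))) (ℤₚ.+-identityʳ _)

pow-binomialMinusOne : ∀ k j m → pow (binomialMinusOne k) j m ≡ sumTo j (λ i₂ → signedBinom j i₂ ℤ.* + ((k * i₂) C m))
pow-binomialMinusOne k j m = trans (pow-⊝𝟙 (pow (linear 1 1) k) j m) (sumTo-cong j (λ i₂ _ →
  cong (ℤ._*_ (signedBinom j i₂)) (trans (sym (pow-* (linear 1 1) k i₂ m)) (pow-1+z (k * i₂) m))))

chainSeries : ℕ → ℕ → ℕ → Series
chainSeries s k ρ = linear s ρ ⊛ binomialMinusOne k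

pow-chainSeries : ∀ s k ρ j n → pow (chainSeries s k ρ) j n ≡
  sumTo n (λ i → + (s ^ (j ∸ i) * ρ ^ i * (j C i)) ℤ.* sumTo j (λ i₂ → signedBinom j i₂ ℤ.* + ((k * i₂) C (n ∸ i))))
pow-chainSeries s k ρ j n = trans (pow-⊛ (linear s ρ) (binomialMinusOne k) j n)
  (sumTo-cong n (λ i _ → cong₂ ℤ._*_ (pow-linear s ρ j i) (pow-binomialMinusOne k j (n ∸ i))))

chainSeries-zero : ∀ s k ρ → chainSeries s k ρ 0 ≡ + 0
chainSeries-zero s k ρ = begin
  chainSeries s k ρ 0                                   ≡⟨ linear-⊛ s ρ (binomialMinusOne k) 0 ⟩
  + s ℤ.* binomialMinusOne k 0 ℤ.+ + ρ ℤ.* + 0          ≡⟨ cong₂ ℤ._+_ (cong (ℤ._*_ (+ s)) (binomialMinusOne-zero k))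
                                                                     (ℤₚ.*-zeroʳ (+ ρ)) ⟩
  + s ℤ.* + 0 ℤ.+ + 0                                   ≡⟨ cong (ℤ._+ + 0) (ℤₚ.*-zeroʳ (+ s)) ⟩
  + 0                                                   ∎
  where open ≡-Reasoning

chainSeries-one : ∀ s k ρ → chainSeries s k ρ 1 ≡ + (s * k)
chainSeries-one s k ρ = begin
  chainSeries s k ρ 1                                   ≡⟨ linear-⊛ s ρ (binomialMinusOne k) 1 ⟩
  + s ℤ.* binomialMinusOne k 1 ℤ.+ + ρ ℤ.* binomialMinusOne k 0
    ≡⟨ cong₂ (λ x y → + s ℤ.* x ℤ.+ + ρ ℤ.* y) (trans (binomialMinusOne-suc k 0) (cong +_ (nC1≡n k)))
                                                 (binomialMinusOne-zero k) ⟩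
  + s ℤ.* + k ℤ.+ + ρ ℤ.* + 0                           ≡⟨ cong₂ ℤ._+_ (sym (ℤₚ.pos-* s k)) (ℤₚ.*-zeroʳ (+ ρ)) ⟩
  + (s * k) ℤ.+ + 0                                     ≡⟨ ℤₚ.+-identityʳ _ ⟩
  + (s * k)                                             ∎
  where open ≡-Reasoning

chainSeries-suc-suc : ∀ s k ρ ℓ → chainSeries s k ρ (suc (suc ℓ)) ≡ + (s * (k C suc (suc ℓ)) + ρ * (k C suc ℓ))
chainSeries-suc-suc s k ρ ℓ = begin
  chainSeries s k ρ (suc (suc ℓ))
    ≡⟨ linear-⊛ s ρ (binomialMinusOne k) (suc (suc ℓ)) ⟩
  + s ℤ.* binomialMinusOne k (suc (suc ℓ)) ℤ.+ + ρ ℤ.* binomialMinusOne k (suc ℓ)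
    ≡⟨ cong₂ (λ x y → + s ℤ.* x ℤ.+ + ρ ℤ.* y) (binomialMinusOne-suc k (suc ℓ)) (binomialMinusOne-suc k ℓ) ⟩
  + s ℤ.* + (k C suc (suc ℓ)) ℤ.+ + ρ ℤ.* + (k C suc ℓ)
    ≡⟨ cong₂ ℤ._+_ (ℤₚ.pos-* s _) (ℤₚ.pos-* ρ _) ⟨
  + (s * (k C suc (suc ℓ)) + ρ * (k C suc ℓ))
    ∎
  where open ≡-Reasoning

module _ (g : Series) where

  pow-shift-suc : ∀ j n → pow (shift g) (suc j) (suc n) ≡ sumTo n (λ ℓ → g ℓ ℤ.* pow (shift g) j (n ∸ ℓ))
  pow-shift-suc j n = trans (sumTo-suc n _) (ℤₚ.+-identityˡ _)

  pow-shift-vanish : ∀ j n → n < j → pow (shift g) j n ≡ + 0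
  pow-shift-vanish (suc j) zero    _         = refl
  pow-shift-vanish (suc j) (suc n) (s≤s n<j) = trans (pow-shift-suc j n) (sumTo-≡0 n vanish)
    where
    vanish : ∀ ℓ → ℓ ≤ n → g ℓ ℤ.* pow (shift g) j (n ∸ ℓ) ≡ + 0
    vanish ℓ _ = trans (cong (ℤ._*_ (g ℓ)) (pow-shift-vanish j (n ∸ ℓ) (ℕₚ.≤-<-trans (ℕₚ.m∸n≤m n ℓ) n<j)))
                       (ℤₚ.*-zeroʳ (g ℓ))

-- Multiplication by t − 1

δ : Series → Series
δ f = shift f ⊕ ⊝ f

δ^ : ℕ → Series → Series
δ^ zero    f = f
δ^ (suc m) f = δ (δ^ m f)

δ-cong : ∀ {f g} → f ≗ g → δ f ≗ δ g
δ-cong f≗g n = cong₂ ℤ._+_ (shift-cong f≗g n) (cong -_ (f≗g n))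

δ^-cong : ∀ m {f g} → f ≗ g → δ^ m f ≗ δ^ m g
δ^-cong zero    f≗g = f≗g
δ^-cong (suc m) f≗g = δ-cong (δ^-cong m f≗g)

δ^-+ : ∀ a b f → δ^ a (δ^ b f) ≗ δ^ (a + b) f
δ^-+ zero    b f = λ _ → refl
δ^-+ (suc a) b f = δ-cong (δ^-+ a b f)

δ-∙ : ∀ c f → δ (c ∙ f) ≗ c ∙ δ f
δ-∙ c f zero    = begin
  + 0 ℤ.+ - (c ℤ.* f 0)     ≡⟨ ℤₚ.+-identityˡ _ ⟩
  - (c ℤ.* f 0)             ≡⟨ ℤₚ.neg-distribʳ-* c (f 0) ⟩
  c ℤ.* - f 0               ≡⟨ cong (ℤ._*_ c) (ℤₚ.+-identityˡ (- f 0)) ⟨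
  c ℤ.* (+ 0 ℤ.+ - f 0)     ∎
  where open ≡-Reasoning
δ-∙ c f (suc n) = trans (cong (ℤ._+_ (c ℤ.* f n)) (ℤₚ.neg-distribʳ-* c (f (suc n))))
                        (sym (ℤₚ.*-distribˡ-+ c (f n) (- f (suc n))))

δ^-∙ : ∀ m c f → δ^ m (c ∙ f) ≗ c ∙ δ^ m f
δ^-∙ zero    c f = λ _ → refl
δ^-∙ (suc m) c f = begin
  δ (δ^ m (c ∙ f))   ≈⟨ δ-cong (δ^-∙ m c f) ⟩
  δ (c ∙ δ^ m f)     ≈⟨ δ-∙ c (δ^ m f) ⟩
  c ∙ δ (δ^ m f)     ∎
  where open ≗-Reasoning

δ^-𝟘 : ∀ m f → f ≗ 𝟘 → δ^ m f ≗ 𝟘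
δ^-𝟘 zero    f f≗𝟘 = f≗𝟘
δ^-𝟘 (suc m) f f≗𝟘 zero    = cong (λ x → + 0 ℤ.+ - x) (δ^-𝟘 m f f≗𝟘 0)
δ^-𝟘 (suc m) f f≗𝟘 (suc n) = cong₂ (λ x y → x ℤ.+ - y) (δ^-𝟘 m f f≗𝟘 n) (δ^-𝟘 m f f≗𝟘 (suc n))

δ-sumToₛ : ∀ m (F : ℕ → Series) → δ (sumToₛ m F) ≗ sumToₛ m (λ i → δ (F i))
δ-sumToₛ m F n = trans (cong₂ ℤ._+_ (shift-sumTo n) (neg-distrib-sumTo m _)) (sym (sumTo-+ m _ _))
  where
  shift-sumTo : ∀ n → shift (sumToₛ m F) n ≡ sumTo m (λ i → shift (F i) n)
  shift-sumTo zero    = sym (sumTo-≡0 m (λ _ _ → refl))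
  shift-sumTo (suc n) = refl

δ^-sumToₛ : ∀ ℓ m (F : ℕ → Series) → δ^ ℓ (sumToₛ m F) ≗ sumToₛ m (λ i → δ^ ℓ (F i))
δ^-sumToₛ zero    m F = λ _ → refl
δ^-sumToₛ (suc ℓ) m F = begin
  δ (δ^ ℓ (sumToₛ m F))               ≈⟨ δ-cong (δ^-sumToₛ ℓ m F) ⟩
  δ (sumToₛ m (λ i → δ^ ℓ (F i)))     ≈⟨ δ-sumToₛ m _ ⟩
  sumToₛ m (λ i → δ^ (suc ℓ) (F i))   ∎
  where open ≗-Reasoning

δ^-𝟙 : ∀ m p → δ^ m 𝟙 p ≡ signedBinom m p
δ^-𝟙 zero    zero    = refl
δ^-𝟙 zero    (suc p) = sym (ℤₚ.*-zeroʳ (-1ℤ ℤ.^ suc p))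
δ^-𝟙 (suc m) zero    = trans (ℤₚ.+-identityˡ _) (trans (cong -_ (δ^-𝟙 m 0)) (sym (signedBinom-suc-zero m)))
δ^-𝟙 (suc m) (suc p) =
  trans (cong₂ (λ x y → x ℤ.+ - y) (δ^-𝟙 m p) (δ^-𝟙 m (suc p))) (sym (signedBinom-pascal m p))

module RecurrenceSolution (g : Series) (P : ℕ → Series)
  (P-zero : P 0 ≗ 𝟙)
  (P-suc : ∀ n → P (suc n) ≗ sumToₛ n (λ ℓ → δ^ ℓ (g ℓ ∙ P (n ∸ ℓ)))) where

  closedForm : ℕ → Series
  closedForm n = sumToₛ n (λ j → δ^ (n ∸ j) (pow (shift g) j n ∙ 𝟙))

  private
    A : ℕ → ℕ → ℤ
    A j n = pow (shift g) j n

    δ^-∙-δ^ : ∀ a b c d → δ^ a (c ∙ δ^ b (d ∙ 𝟙)) ≗ δ^ (a + b) ((c ℤ.* d) ∙ 𝟙)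
    δ^-∙-δ^ a b c d = begin
      δ^ a (c ∙ δ^ b (d ∙ 𝟙))      ≈⟨ δ^-cong a (δ^-∙ b c (d ∙ 𝟙)) ⟨
      δ^ a (δ^ b (c ∙ d ∙ 𝟙))      ≈⟨ δ^-+ a b _ ⟩
      δ^ (a + b) (c ∙ d ∙ 𝟙)       ≈⟨ δ^-cong (a + b) (λ n → sym (ℤₚ.*-assoc c d (𝟙 n))) ⟩
      δ^ (a + b) ((c ℤ.* d) ∙ 𝟙)   ∎
      where open ≗-Reasoning

    δ^-∙-closedForm : ∀ m ℓ c → ℓ ≤ m →
      δ^ ℓ (c ∙ closedForm (m ∸ ℓ)) ≗ sumToₛ m (λ j → δ^ (m ∸ j) ((c ℤ.* A j (m ∸ ℓ)) ∙ 𝟙))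
    δ^-∙-closedForm m ℓ c ℓ≤m = begin
      δ^ ℓ (c ∙ closedForm (m ∸ ℓ))
        ≈⟨ δ^-cong ℓ (λ n → *-distribˡ-sumTo (m ∸ ℓ) c _) ⟩
      δ^ ℓ (sumToₛ (m ∸ ℓ) (λ j → c ∙ δ^ (m ∸ ℓ ∸ j) (A j (m ∸ ℓ) ∙ 𝟙)))
        ≈⟨ δ^-sumToₛ ℓ (m ∸ ℓ) _ ⟩
      sumToₛ (m ∸ ℓ) (λ j → δ^ ℓ (c ∙ δ^ (m ∸ ℓ ∸ j) (A j (m ∸ ℓ) ∙ 𝟙)))
        ≈⟨ sumToₛ-cong (m ∸ ℓ) (λ j _ → δ^-∙-δ^ ℓ (m ∸ ℓ ∸ j) c _) ⟩
      sumToₛ (m ∸ ℓ) (λ j → δ^ (ℓ + (m ∸ ℓ ∸ j)) ((c ℤ.* A j (m ∸ ℓ)) ∙ 𝟙))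
        ≈⟨ sumToₛ-cong (m ∸ ℓ) (λ j j≤ n → cong (λ e → δ^ e ((c ℤ.* A j (m ∸ ℓ)) ∙ 𝟙) n) (exponent j j≤)) ⟩
      sumToₛ (m ∸ ℓ) (λ j → δ^ (m ∸ j) ((c ℤ.* A j (m ∸ ℓ)) ∙ 𝟙))
        ≈⟨ (λ n → sumTo-extend _ (ℕₚ.m∸n≤m m ℓ) (λ j j> → δ^-𝟘 (m ∸ j) _ (vanish j j>) n)) ⟨
      sumToₛ m (λ j → δ^ (m ∸ j) ((c ℤ.* A j (m ∸ ℓ)) ∙ 𝟙))
        ∎
      where
      open ≗-Reasoning
      exponent : ∀ j → j ≤ m ∸ ℓ → ℓ + (m ∸ ℓ ∸ j) ≡ m ∸ j
      exponent j j≤ = trans (sym (ℕₚ.+-∸-assoc ℓ j≤)) (cong (_∸ j) (ℕₚ.m+[n∸m]≡n ℓ≤m))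
      vanish : ∀ j → m ∸ ℓ < j → (c ℤ.* A j (m ∸ ℓ)) ∙ 𝟙 ≗ 𝟘
      vanish j j> n = trans (cong (λ x → c ℤ.* x ℤ.* 𝟙 n) (pow-shift-vanish g j (m ∸ ℓ) j>))
                            (cong (ℤ._* 𝟙 n) (ℤₚ.*-zeroʳ c))

    closedForm-suc-shifted : ∀ m → closedForm (suc m) ≗ sumToₛ m (λ j → δ^ (m ∸ j) (A (suc j) (suc m) ∙ 𝟙))
    closedForm-suc-shifted m n = begin
      closedForm (suc m) n                             ≡⟨ sumTo-suc m _ ⟩
      δ^ (suc m) (A 0 (suc m) ∙ 𝟙) n ℤ.+ rest
                                                       ≡⟨ cong (ℤ._+ rest) (δ^-𝟘 (suc m) (A 0 (suc m) ∙ 𝟙) (λ _ → refl) n) ⟩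
      + 0 ℤ.+ rest                                     ≡⟨ ℤₚ.+-identityˡ rest ⟩
      rest                                             ∎
      where
      open ≡-Reasoning
      rest = sumTo m (λ j → δ^ (m ∸ j) (A (suc j) (suc m) ∙ 𝟙) n)

    closedForm-suc : ∀ m → (∀ m′ → m′ ≤ m → P m′ ≗ closedForm m′) → P (suc m) ≗ closedForm (suc m)
    closedForm-suc m IH = begin
      P (suc m)
        ≈⟨ P-suc m ⟩
      sumToₛ m (λ ℓ → δ^ ℓ (g ℓ ∙ P (m ∸ ℓ)))
        ≈⟨ sumToₛ-cong m (λ ℓ _ → δ^-cong ℓ (λ t → cong (ℤ._*_ (g ℓ)) (IH (m ∸ ℓ) (ℕₚ.m∸n≤m m ℓ) t))) ⟩
      sumToₛ m (λ ℓ → δ^ ℓ (g ℓ ∙ closedForm (m ∸ ℓ)))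
        ≈⟨ sumToₛ-cong m (λ ℓ ℓ≤m → δ^-∙-closedForm m ℓ (g ℓ) ℓ≤m) ⟩
      sumToₛ m (λ ℓ → sumToₛ m (λ j → δ^ (m ∸ j) ((g ℓ ℤ.* A j (m ∸ ℓ)) ∙ 𝟙)))
        ≈⟨ (λ n → sumTo-swap m m _) ⟩
      sumToₛ m (λ j → sumToₛ m (λ ℓ → δ^ (m ∸ j) ((g ℓ ℤ.* A j (m ∸ ℓ)) ∙ 𝟙)))
        ≈⟨ sumToₛ-cong m (λ j _ → δ^-sumToₛ (m ∸ j) m _) ⟨
      sumToₛ m (λ j → δ^ (m ∸ j) (sumToₛ m (λ ℓ → (g ℓ ℤ.* A j (m ∸ ℓ)) ∙ 𝟙)))
        ≈⟨ sumToₛ-cong m (λ j _ → δ^-cong (m ∸ j) (λ t → sym (*-distribʳ-sumTo m (𝟙 t) _))) ⟩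
      sumToₛ m (λ j → δ^ (m ∸ j) (sumTo m (λ ℓ → g ℓ ℤ.* A j (m ∸ ℓ)) ∙ 𝟙))
        ≈⟨ sumToₛ-cong m (λ j _ → δ^-cong (m ∸ j) (λ t → cong (ℤ._* 𝟙 t) (pow-shift-suc g j m))) ⟨
      sumToₛ m (λ j → δ^ (m ∸ j) (A (suc j) (suc m) ∙ 𝟙))
        ≈⟨ closedForm-suc-shifted m ⟨
      closedForm (suc m)
        ∎
      where open ≗-Reasoning

    P≗closedForm-≤ : ∀ n m → m ≤ n → P m ≗ closedForm m
    P≗closedForm-≤ n       zero    _         = λ t → trans (P-zero t) (sym (ℤₚ.*-identityˡ (𝟙 t)))
    P≗closedForm-≤ (suc n) (suc m) (s≤s m≤n) =
      closedForm-suc m (λ m′ m′≤m → P≗closedForm-≤ n m′ (ℕₚ.≤-trans m′≤m m≤n))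

  P≗closedForm : ∀ n → P n ≗ closedForm n
  P≗closedForm n = P≗closedForm-≤ n n ℕₚ.≤-refl

  closedForm-coefficient : ∀ n p → closedForm n p ≡ sumTo n (λ j → A j n ℤ.* signedBinom (n ∸ j) p)
  closedForm-coefficient n p = sumTo-cong n (λ j _ →
    trans (δ^-∙ (n ∸ j) (A j n) 𝟙 p) (cong (ℤ._*_ (A j n)) (δ^-𝟙 (n ∸ j) p)))

sumL : {A : Set} → List A → (A → ℤ) → ℤ
sumL []       f = + 0
sumL (x ∷ xs) f = f x ℤ.+ sumL xs f

sumLₛ : {A : Set} → List A → (A → Series) → Series
sumLₛ l F n = sumL l (λ x → F x n)

module _ {A : Set} where

  sumL-cong : ∀ (l : List A) {f g : A → ℤ} → (∀ x → f x ≡ g x) → sumL l f ≡ sumL l g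
  sumL-cong []       f≗g = refl
  sumL-cong (x ∷ xs) f≗g = cong₂ ℤ._+_ (f≗g x) (sumL-cong xs f≗g)

  sumL-++ : ∀ (xs ys : List A) f → sumL (xs ++ ys) f ≡ sumL xs f ℤ.+ sumL ys f
  sumL-++ []       ys f = sym (ℤₚ.+-identityˡ _)
  sumL-++ (x ∷ xs) ys f = trans (cong (ℤ._+_ (f x)) (sumL-++ xs ys f)) (sym (ℤₚ.+-assoc (f x) _ _))

  sumL-concatMap : ∀ {B : Set} (G : B → List A) (l : List B) f →
    sumL (concatMap G l) f ≡ sumL l (λ b → sumL (G b) f)
  sumL-concatMap G []       f = refl
  sumL-concatMap G (b ∷ bs) f = trans (sumL-++ (G b) _ f) (cong (ℤ._+_ (sumL (G b) f)) (sumL-concatMap G bs f))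

  sumL-map : ∀ {B : Set} (h : B → A) (l : List B) f → sumL (map h l) f ≡ sumL l (λ x → f (h x))
  sumL-map h []       f = refl
  sumL-map h (x ∷ xs) f = cong (ℤ._+_ (f (h x))) (sumL-map h xs f)

  sumL-+ : ∀ (l : List A) f g → sumL l (λ x → f x ℤ.+ g x) ≡ sumL l f ℤ.+ sumL l g
  sumL-+ []       f g = refl
  sumL-+ (x ∷ xs) f g =
    trans (cong (ℤ._+_ (f x ℤ.+ g x)) (sumL-+ xs f g)) (+-interchange (f x) (g x) (sumL xs f) (sumL xs g))

  neg-distrib-sumL : ∀ (l : List A) f → - sumL l f ≡ sumL l (λ x → - f x)
  neg-distrib-sumL []       f = refl
  neg-distrib-sumL (x ∷ xs) f =
    trans (ℤₚ.neg-distrib-+ (f x) (sumL xs f)) (cong (ℤ._+_ (- f x)) (neg-distrib-sumL xs f))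

  sumL-zero : ∀ (l : List A) → sumL l (λ _ → + 0) ≡ + 0
  sumL-zero []       = refl
  sumL-zero (x ∷ xs) = trans (ℤₚ.+-identityˡ _) (sumL-zero xs)

  sumL-sumTo : ∀ (l : List A) m (f : A → ℕ → ℤ) →
    sumL l (λ x → sumTo m (f x)) ≡ sumTo m (λ i → sumL l (λ x → f x i))
  sumL-sumTo []       m f = sym (sumTo-≡0 m (λ _ _ → refl))
  sumL-sumTo (x ∷ xs) m f = trans (cong (ℤ._+_ (sumTo m (f x))) (sumL-sumTo xs m f)) (sym (sumTo-+ m _ _))

  sumLₛ-∙ : ∀ (l : List A) (c : A → ℤ) f → sumLₛ l (λ x → c x ∙ f) ≗ sumL l c ∙ f
  sumLₛ-∙ []       c f n = refl
  sumLₛ-∙ (x ∷ xs) c f n =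
    trans (cong (ℤ._+_ (c x ℤ.* f n)) (sumLₛ-∙ xs c f n)) (sym (ℤₚ.*-distribʳ-+ (f n) (c x) (sumL xs c)))

  δ-sumLₛ : ∀ (l : List A) F → δ (sumLₛ l F) ≗ sumLₛ l (λ x → δ (F x))
  δ-sumLₛ l F zero    = begin
    + 0 ℤ.+ - sumL l (λ x → F x 0)                       ≡⟨ ℤₚ.+-identityˡ _ ⟩
    - sumL l (λ x → F x 0)                               ≡⟨ neg-distrib-sumL l _ ⟩
    sumL l (λ x → - F x 0)                               ≡⟨ ℤₚ.+-identityˡ _ ⟨
    + 0 ℤ.+ sumL l (λ x → - F x 0)                       ≡⟨ cong (ℤ._+ sumL l (λ x → - F x 0)) (sumL-zero l) ⟨
    sumL l (λ _ → + 0) ℤ.+ sumL l (λ x → - F x 0)        ≡⟨ sumL-+ l _ _ ⟨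
    sumL l (λ x → + 0 ℤ.+ - F x 0)                       ∎
    where open ≡-Reasoning
  δ-sumLₛ l F (suc n) =
    trans (cong (ℤ._+_ (sumL l (λ x → F x n))) (neg-distrib-sumL l _)) (sym (sumL-+ l _ _))

  δ^-sumLₛ : ∀ ℓ (l : List A) F → δ^ ℓ (sumLₛ l F) ≗ sumLₛ l (λ x → δ^ ℓ (F x))
  δ^-sumLₛ zero    l F = λ _ → refl
  δ^-sumLₛ (suc ℓ) l F = begin
    δ (δ^ ℓ (sumLₛ l F))               ≈⟨ δ-cong (δ^-sumLₛ ℓ l F) ⟩
    δ (sumLₛ l (λ x → δ^ ℓ (F x)))     ≈⟨ δ-sumLₛ l _ ⟩
    sumLₛ l (λ x → δ^ (suc ℓ) (F x))   ∎
    where open ≗-Reasoning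

sumL-range-suc : ∀ M (f : ℕ → ℤ) → sumL (range1 (suc M)) f ≡ sumL (range1 M) f ℤ.+ f (suc M)
sumL-range-suc M f =
  trans (sumL-++ (range1 M) (suc M ∷ []) f) (cong (ℤ._+_ (sumL (range1 M) f)) (ℤₚ.+-identityʳ (f (suc M))))

sumL-range-cong : ∀ M {f g : ℕ → ℤ} → (∀ b → 1 ≤ b → b ≤ M → f b ≡ g b) →
  sumL (range1 M) f ≡ sumL (range1 M) g
sumL-range-cong zero    f≗g = refl
sumL-range-cong (suc M) {f} {g} f≗g = begin
  sumL (range1 (suc M)) f          ≡⟨ sumL-range-suc M f ⟩
  sumL (range1 M) f ℤ.+ f (suc M)  ≡⟨ cong₂ ℤ._+_ (sumL-range-cong M (λ b 1≤b b≤M →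
                                                                 f≗g b 1≤b (ℕₚ.m≤n⇒m≤1+n b≤M)))
                                                  (f≗g (suc M) (s≤s z≤n) ℕₚ.≤-refl) ⟩
  sumL (range1 M) g ℤ.+ g (suc M)  ≡⟨ sumL-range-suc M g ⟨
  sumL (range1 (suc M)) g          ∎
  where open ≡-Reasoning

sumLₛ-below : ∀ M a (F : ℕ → Series) →
  sumLₛ (range1 M) (λ b → if b <ᵇ suc a then F b else 𝟘) ≗ sumLₛ (range1 (M ⊓ a)) F
sumLₛ-below zero    a F n = refl
sumLₛ-below (suc M) a F n = begin
  sumL (range1 (suc M)) (λ b → F< b n)
    ≡⟨ sumL-range-suc M (λ b → F< b n) ⟩
  sumL (range1 M) (λ b → F< b n) ℤ.+ F< (suc M) n
    ≡⟨ cong (ℤ._+ F< (suc M) n) (sumLₛ-below M a F n) ⟩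
  sumL (range1 (M ⊓ a)) (λ b → F b n) ℤ.+ (if M <ᵇ a then F (suc M) else 𝟘) n
    ≡⟨ last-letter (M <? a) ⟩
  sumL (range1 (suc M ⊓ a)) (λ b → F b n)
    ∎
  where
  open ≡-Reasoning
  F< = λ b → if b <ᵇ suc a then F b else 𝟘
  last-letter : Dec (M < a) →
    sumL (range1 (M ⊓ a)) (λ b → F b n) ℤ.+ (if M <ᵇ a then F (suc M) else 𝟘) n ≡ sumL (range1 (suc M ⊓ a)) (λ b → F b n)
  last-letter (yes M<a) rewrite dec-true (M <? a) M<a | ℕₚ.m≤n⇒m⊓n≡m (ℕₚ.<⇒≤ M<a) | ℕₚ.m≤n⇒m⊓n≡m M<a =
    sym (sumL-range-suc M (λ b → F b n))
  last-letter (no M≮a) rewrite dec-false (M <? a) M≮a | ℕₚ.m≥n⇒m⊓n≡n (ℕₚ.≮⇒≥ M≮a)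
                             | ℕₚ.m≥n⇒m⊓n≡n (ℕₚ.m≤n⇒m≤1+n (ℕₚ.≮⇒≥ M≮a)) =
    ℤₚ.+-identityʳ _

range1-suc-front : ∀ M → range1 (suc M) ≡ 1 ∷ map suc (range1 M)
range1-suc-front zero    = refl
range1-suc-front (suc M) =
  trans (cong (_++ (suc (suc M) ∷ [])) (range1-suc-front M)) (cong (1 ∷_) (sym (map-++ suc (range1 M) _)))

sumL-range-reverse : ∀ M (f : ℕ → ℤ) → sumL (range1 M) f ≡ sumL (range1 M) (λ b → f (suc M ∸ b))
sumL-range-reverse zero    f = refl
sumL-range-reverse (suc M) f = begin
  sumL (range1 (suc M)) f                                ≡⟨ sumL-range-suc M f ⟩
  sumL (range1 M) f ℤ.+ f (suc M)                        ≡⟨ cong (ℤ._+ f (suc M)) (sumL-range-reverse M f) ⟩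
  sumL (range1 M) (λ b → f (suc M ∸ b)) ℤ.+ f (suc M)    ≡⟨ ℤₚ.+-comm _ (f (suc M)) ⟩
  f (suc M) ℤ.+ sumL (range1 M) (λ b → f (suc M ∸ b))    ≡⟨ cong (ℤ._+_ (f (suc M))) (sumL-map suc (range1 M) _) ⟨
  sumL (1 ∷ map suc (range1 M)) (λ b → f (suc (suc M) ∸ b))
    ≡⟨ cong (λ l → sumL l (λ b → f (suc (suc M) ∸ b))) (range1-suc-front M) ⟨
  sumL (range1 (suc M)) (λ b → f (suc (suc M) ∸ b))      ∎
  where open ≡-Reasoning

+-sumℕ : ∀ {A : Set} (l : List A) f → + sum (map f l) ≡ sumL l (λ x → + f x)
+-sumℕ []       f = refl
+-sumℕ (x ∷ xs) f = trans (ℤₚ.pos-+ (f x) (sum (map f xs))) (cong (ℤ._+_ (+ f x)) (+-sumℕ xs f))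

-- Generating functions of words and chains

adjacencies : (ℕ → ℕ → Bool) → List ℕ → ℕ
adjacencies e []          = 0
adjacencies e (a ∷ [])    = 0
adjacencies e (a ∷ b ∷ π) = (if e a b then 1 else 0) + adjacencies e (b ∷ π)

descentAt ascentAt : (ℕ → Bool) → ℕ → ℕ → Bool
descentAt X a b = X a ∧ (b <ᵇ a)
ascentAt  X a b = X a ∧ (a <ᵇ b)

desR≡adjacencies : ∀ s c π → desR s c π ≡ adjacencies (descentAt (inR s c)) π
desR≡adjacencies s c []          = refl
desR≡adjacencies s c (a ∷ [])    = refl
desR≡adjacencies s c (a ∷ b ∷ π) =
  cong₂ (λ x y → (if x then 1 else 0) + y) (∧-comm (b <ᵇ a) (inR s c a)) (desR≡adjacencies s c (b ∷ π))

risR≡adjacencies : ∀ s c π → risR s c π ≡ adjacencies (ascentAt (inR s c)) π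
risR≡adjacencies s c []          = refl
risR≡adjacencies s c (a ∷ [])    = refl
risR≡adjacencies s c (a ∷ b ∷ π) =
  cong₂ (λ x y → (if x then 1 else 0) + y) (∧-comm (a <ᵇ b) (inR s c a)) (risR≡adjacencies s c (b ∷ π))

monomial : ℕ → Series
monomial d p = if d ≡ᵇ p then + 1 else + 0

monomial-zero : monomial 0 ≗ 𝟙
monomial-zero zero    = refl
monomial-zero (suc p) = refl

monomial-suc : ∀ d → monomial (suc d) ≗ shift (monomial d)
monomial-suc d zero    = refl
monomial-suc d (suc p) = refl

shift≗id⊕δ : ∀ f → shift f ≗ f ⊕ δ f
shift≗id⊕δ f n = sym (begin
  f n ℤ.+ (shift f n ℤ.+ - f n)   ≡⟨ cong (ℤ._+_ (f n)) (ℤₚ.+-comm (shift f n) (- f n)) ⟩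
  f n ℤ.+ (- f n ℤ.+ shift f n)   ≡⟨ ℤₚ.+-assoc (f n) (- f n) (shift f n) ⟨
  f n ℤ.+ - f n ℤ.+ shift f n     ≡⟨ cong (ℤ._+ shift f n) (ℤₚ.+-inverseʳ (f n)) ⟩
  + 0 ℤ.+ shift f n               ≡⟨ ℤₚ.+-identityˡ (shift f n) ⟩
  shift f n                       ∎)
  where open ≡-Reasoning

monomial-step : ∀ x d → monomial ((if x then 1 else 0) + d) ≗ monomial d ⊕ δ (if x then monomial d else 𝟘)
monomial-step true  d n = trans (monomial-suc d n) (shift≗id⊕δ (monomial d) n)
monomial-step false d zero    = sym (ℤₚ.+-identityʳ (monomial d 0))
monomial-step false d (suc n) = sym (ℤₚ.+-identityʳ (monomial d (suc n)))

countWords≡coefficient : ∀ stat N n p →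
  + countWords stat N n p ≡ sumLₛ (words N n) (λ π → monomial (stat π)) p
countWords≡coefficient stat N n p = count (words N n)
  where
  count : ∀ l → + length (filterᵇ (λ π → stat π ≡ᵇ p) l) ≡ sumL l (λ π → monomial (stat π) p)
  count []      = refl
  count (π ∷ l) with stat π ≡ᵇ p
  ... | true  = trans (ℤₚ.pos-+ 1 _) (cong (ℤ._+_ (+ 1)) (count l))
  ... | false = trans (count l) (sym (ℤₚ.+-identityˡ _))

sumLₛ-if : ∀ {A : Set} (l : List A) x F → sumLₛ l (λ w → if x then F w else 𝟘) ≗ (if x then sumLₛ l F else 𝟘)
sumLₛ-if l true  F n = refl
sumLₛ-if l false F n = sumL-zero l

sumL-words-suc : ∀ N n (f : List ℕ → ℤ) →
  sumL (words N (suc n)) f ≡ sumL (range1 N) (λ a → sumL (words N n) (λ w → f (a ∷ w)))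
sumL-words-suc N n f =
  trans (sumL-concatMap _ (range1 N) f) (sumL-cong (range1 N) (λ a → sumL-map (a ∷_) (words N n) f))

module WordSeries (N : ℕ) (e : ℕ → ℕ → Bool) where

  P : ℕ → Series
  P n = sumLₛ (words N n) (λ π → monomial (adjacencies e π))

  P-from : ℕ → ℕ → Series
  P-from a n = sumLₛ (words N n) (λ w → monomial (adjacencies e (a ∷ w)))

  P-zero : P 0 ≗ 𝟙
  P-zero p = trans (ℤₚ.+-identityʳ _) (monomial-zero p)

  P-from-zero : ∀ a → P-from a 0 ≗ 𝟙
  P-from-zero a = P-zero

  P-suc : ∀ n → P (suc n) ≗ sumLₛ (range1 N) (λ a → P-from a n)
  P-suc n p = sumL-words-suc N n _

  P-from-suc : ∀ a n →
    P-from a (suc n) ≗ P (suc n) ⊕ δ (sumLₛ (range1 N) (λ b → if e a b then P-from b n else 𝟘))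
  P-from-suc a n p = begin
    P-from a (suc n) p
      ≡⟨ sumL-words-suc N n _ ⟩
    sumL (range1 N) (λ b → sumL (words N n) (λ w → monomial (adjacencies e (a ∷ b ∷ w)) p))
      ≡⟨ sumL-cong (range1 N) second-letter ⟩
    sumL (range1 N) (λ b → P-from b n p ℤ.+ δ (if e a b then P-from b n else 𝟘) p)
      ≡⟨ sumL-+ (range1 N) _ _ ⟩
    sumL (range1 N) (λ b → P-from b n p) ℤ.+ sumL (range1 N) (λ b → δ (if e a b then P-from b n else 𝟘) p)
      ≡⟨ cong₂ ℤ._+_ (P-suc n p) (δ-sumLₛ (range1 N) _ p) ⟨
    P (suc n) p ℤ.+ δ (sumLₛ (range1 N) (λ b → if e a b then P-from b n else 𝟘)) p
      ∎
    where
    open ≡-Reasoning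
    second-letter : ∀ b → sumL (words N n) (λ w → monomial (adjacencies e (a ∷ b ∷ w)) p)
                          ≡ P-from b n p ℤ.+ δ (if e a b then P-from b n else 𝟘) p
    second-letter b = begin
      sumL (words N n) (λ w → monomial (adjacencies e (a ∷ b ∷ w)) p)
        ≡⟨ sumL-cong (words N n) (λ w → monomial-step (e a b) (adjacencies e (b ∷ w)) p) ⟩
      sumL (words N n) (λ w → monomial (adjacencies e (b ∷ w)) p ℤ.+ δ (F w) p)
        ≡⟨ sumL-+ (words N n) _ _ ⟩
      P-from b n p ℤ.+ sumL (words N n) (λ w → δ (F w) p)
        ≡⟨ cong (ℤ._+_ (P-from b n p)) (δ-sumLₛ (words N n) F p) ⟨
      P-from b n p ℤ.+ δ (sumLₛ (words N n) F) p
        ≡⟨ cong (ℤ._+_ (P-from b n p)) (δ-cong (sumLₛ-if (words N n) (e a b) _) p) ⟩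
      P-from b n p ℤ.+ δ (if e a b then P-from b n else 𝟘) p
        ∎
      where F = λ w → if e a b then monomial (adjacencies e (b ∷ w)) else 𝟘

-- chains X a ℓ counts the chains a = a₀ > a₁ > ⋯ > a_ℓ ≥ 1 with a₀, …, a_{ℓ−1} ∈ X.
chains : (ℕ → Bool) → ℕ → ℕ → ℕ
chainTotal : (ℕ → Bool) → ℕ → ℕ → ℕ

chains X a zero    = 1
chains X a (suc ℓ) = if X a then chainTotal X (a ∸ 1) ℓ else 0

chainTotal X M ℓ = sum (map (λ a → chains X a ℓ) (range1 M))

sumLₛ-δ^-expansion : ∀ {A : Set} (l : List A) n (h : A → ℕ → ℕ) (F : ℕ → Series) →
  sumLₛ l (λ b → sumToₛ n (λ ℓ → δ^ ℓ (+ h b ℓ ∙ F ℓ)))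
  ≗ sumToₛ n (λ ℓ → δ^ ℓ (+ sum (map (λ b → h b ℓ) l) ∙ F ℓ))
sumLₛ-δ^-expansion l n h F = begin
  sumLₛ l (λ b → sumToₛ n (λ ℓ → δ^ ℓ (+ h b ℓ ∙ F ℓ)))
    ≈⟨ (λ p → sumL-sumTo l n _) ⟩
  sumToₛ n (λ ℓ → sumLₛ l (λ b → δ^ ℓ (+ h b ℓ ∙ F ℓ)))
    ≈⟨ sumToₛ-cong n (λ ℓ _ → δ^-sumLₛ ℓ l _) ⟨
  sumToₛ n (λ ℓ → δ^ ℓ (sumLₛ l (λ b → + h b ℓ ∙ F ℓ)))
    ≈⟨ sumToₛ-cong n (λ ℓ _ → δ^-cong ℓ (sumLₛ-∙ l (λ b → + h b ℓ) (F ℓ))) ⟩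
  sumToₛ n (λ ℓ → δ^ ℓ (sumL l (λ b → + h b ℓ) ∙ F ℓ))
    ≈⟨ sumToₛ-cong n (λ ℓ _ → δ^-cong ℓ (λ t → cong (ℤ._* F ℓ t) (+-sumℕ l (λ b → h b ℓ)))) ⟨
  sumToₛ n (λ ℓ → δ^ ℓ (+ sum (map (λ b → h b ℓ) l) ∙ F ℓ))
    ∎
  where open ≗-Reasoning

module DescentChains (N : ℕ) (X : ℕ → Bool) where

  open WordSeries N (descentAt X) public

  P-from-suc-descent : ∀ a n → 1 ≤ a → a ≤ N →
    P-from a (suc n) ≗ P (suc n) ⊕ δ (if X a then sumLₛ (range1 (a ∸ 1)) (λ b → P-from b n) else 𝟘)
  P-from-suc-descent (suc a) n _ a<N t =
    trans (P-from-suc (suc a) n t) (⊕-congˡ (P (suc n)) (δ-cong below) t)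
    where
    below : sumLₛ (range1 N) (λ b → if X (suc a) ∧ (b <ᵇ suc a) then P-from b n else 𝟘)
            ≗ (if X (suc a) then sumLₛ (range1 a) (λ b → P-from b n) else 𝟘)
    below with X (suc a)
    ... | true  = λ p → trans (sumLₛ-below N a (λ b → P-from b n) p)
                              (cong (λ M → sumL (range1 M) (λ b → P-from b n p)) (ℕₚ.m≥n⇒m⊓n≡n (ℕₚ.<⇒≤ a<N)))
    ... | false = λ p → sumL-zero (range1 N)

  P-from-chains : ∀ n a → 1 ≤ a → a ≤ N → P-from a n ≗ sumToₛ n (λ ℓ → δ^ ℓ (+ chains X a ℓ ∙ P (n ∸ ℓ)))
  P-from-chains zero    a _   _   t = trans (P-from-zero a t) (trans (sym (P-zero t)) (sym (ℤₚ.*-identityˡ (P 0 t))))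
  P-from-chains (suc n) a 1≤a a≤N = begin
    P-from a (suc n)
      ≈⟨ P-from-suc-descent a n 1≤a a≤N ⟩
    P (suc n) ⊕ δ (if X a then sumLₛ (range1 (a ∸ 1)) (λ b → P-from b n) else 𝟘)
      ≈⟨ ⊕-congˡ (P (suc n)) (δ-cong (branch (X a))) ⟩
    P (suc n) ⊕ δ (sumToₛ n (λ ℓ → δ^ ℓ (+ chains X a (suc ℓ) ∙ P (n ∸ ℓ))))
      ≈⟨ ⊕-congˡ (P (suc n)) (δ-sumToₛ n _) ⟩
    P (suc n) ⊕ sumToₛ n (λ ℓ → δ^ (suc ℓ) (+ chains X a (suc ℓ) ∙ P (n ∸ ℓ)))
      ≈⟨ (λ t → trans (sumTo-suc n _) (cong (ℤ._+ sumToₛ n higher t) (ℤₚ.*-identityˡ (P (suc n) t)))) ⟨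
    sumToₛ (suc n) (λ ℓ → δ^ ℓ (+ chains X a ℓ ∙ P (suc n ∸ ℓ)))
      ∎
    where
    open ≗-Reasoning
    higher = λ ℓ → δ^ (suc ℓ) (+ chains X a (suc ℓ) ∙ P (n ∸ ℓ))
    branch : ∀ x → (if x then sumLₛ (range1 (a ∸ 1)) (λ b → P-from b n) else 𝟘)
                   ≗ sumToₛ n (λ ℓ → δ^ ℓ (+ (if x then chainTotal X (a ∸ 1) ℓ else 0) ∙ P (n ∸ ℓ)))
    branch true  t = trans
      (sumL-range-cong (a ∸ 1) (λ b 1≤b b<a →
        P-from-chains n b 1≤b (ℕₚ.≤-trans b<a (ℕₚ.≤-trans (ℕₚ.m∸n≤m a 1) a≤N)) t))
      (sumLₛ-δ^-expansion (range1 (a ∸ 1)) n (chains X) (λ ℓ → P (n ∸ ℓ)) t)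
    branch false t = sym (sumTo-≡0 n (λ ℓ _ → δ^-𝟘 ℓ _ (λ _ → refl) t))

  P-recurrence : ∀ n → P (suc n) ≗ sumToₛ n (λ ℓ → δ^ ℓ (+ chainTotal X N ℓ ∙ P (n ∸ ℓ)))
  P-recurrence n = begin
    P (suc n)
      ≈⟨ P-suc n ⟩
    sumLₛ (range1 N) (λ a → P-from a n)
      ≈⟨ (λ t → sumL-range-cong N (λ a 1≤a a≤N → P-from-chains n a 1≤a a≤N t)) ⟩
    sumLₛ (range1 N) (λ a → sumToₛ n (λ ℓ → δ^ ℓ (+ chains X a ℓ ∙ P (n ∸ ℓ))))
      ≈⟨ sumLₛ-δ^-expansion (range1 N) n (chains X) (λ ℓ → P (n ∸ ℓ)) ⟩
    sumToₛ n (λ ℓ → δ^ ℓ (+ chainTotal X N ℓ ∙ P (n ∸ ℓ)))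
      ∎
    where open ≗-Reasoning

-- Residue classes on blocks of s consecutive letters

residue-injective : ∀ s′ {i c} → 1 ≤ i → i ≤ suc s′ → 1 ≤ c → c ≤ suc s′ →
  i % suc s′ ≡ c % suc s′ → i ≡ c
residue-injective s′ 1≤i i≤s 1≤c c≤s i≡c with ℕₚ.m≤n⇒m<n∨m≡n i≤s | ℕₚ.m≤n⇒m<n∨m≡n c≤s
... | inj₁ i<s  | inj₁ c<s  = trans (sym (m<n⇒m%n≡m i<s)) (trans i≡c (m<n⇒m%n≡m c<s))
... | inj₁ i<s  | inj₂ refl = ⊥-elim (ℕₚ.<⇒≢ 1≤i (sym (trans (sym (m<n⇒m%n≡m i<s)) (trans i≡c (n%n≡0 (suc s′))))))
... | inj₂ refl | inj₁ c<s  = ⊥-elim (ℕₚ.<⇒≢ 1≤c (sym (trans (sym (m<n⇒m%n≡m c<s)) (trans (sym i≡c) (n%n≡0 (suc s′))))))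
... | inj₂ refl | inj₂ refl = refl

inR-block : ∀ s′ c t i → 1 ≤ i → i ≤ suc s′ → 1 ≤ c → c ≤ suc s′ →
  inR (suc s′) c (t * suc s′ + i) ≡ (i ≡ᵇ c)
inR-block s′ c t i 1≤i i≤s 1≤c c≤s = begin
  (t * s + i) % s ≡ᵇ c % s   ≡⟨ cong (λ x → x % s ≡ᵇ c % s) (ℕₚ.+-comm (t * s) i) ⟩
  (i + t * s) % s ≡ᵇ c % s   ≡⟨ cong (_≡ᵇ c % s) ([m+kn]%n≡m%n i t s) ⟩
  i % s ≡ᵇ c % s             ≡⟨ does-≡ (i % s ≟ c % s)
                                        (map′ (cong (_% s)) (residue-injective s′ 1≤i i≤s 1≤c c≤s) (i ≟ c)) ⟩
  i ≡ᵇ c                     ∎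
  where
  open ≡-Reasoning
  s = suc s′

+-if-false : ∀ {x m n} → x ≡ false → m + (if x then n else 0) ≡ m
+-if-false refl = ℕₚ.+-identityʳ _

+-if-true : ∀ {x m n} → x ≡ true → m + (if x then n else 0) ≡ m + n
+-if-true refl = refl

module ResidueChains (s′ r′ : ℕ) (r′≤s′ : r′ ≤ s′) where

  private
    s r : ℕ
    s = suc s′
    r = suc r′

    X : ℕ → Bool
    X = inR s r

    total : ℕ → ℕ → ℕ
    total = chainTotal X

    total-suc : ∀ M ℓ → total (suc M) ℓ ≡ total M ℓ + chains X (suc M) ℓ
    total-suc M ℓ = begin
      sum (map h (range1 M ++ suc M ∷ []))     ≡⟨ cong sum (map-++ h (range1 M) (suc M ∷ [])) ⟩
      sum (map h (range1 M) ++ h (suc M) ∷ []) ≡⟨ sum-++ (map h (range1 M)) (h (suc M) ∷ []) ⟩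
      total M ℓ + (h (suc M) + 0)              ≡⟨ cong (_+_ (total M ℓ)) (ℕₚ.+-identityʳ (h (suc M))) ⟩
      total M ℓ + h (suc M)                    ∎
      where
      open ≡-Reasoning
      h = λ a → chains X a ℓ

    letter : ∀ t i ℓ → i < s →
      total (t * s + suc i) (suc ℓ) ≡ total (t * s + i) (suc ℓ) + (if suc i ≡ᵇ r then total (t * s + i) ℓ else 0)
    letter t i ℓ i<s = begin
      total (t * s + suc i) (suc ℓ)
        ≡⟨ cong (λ M → total M (suc ℓ)) (ℕₚ.+-suc (t * s) i) ⟩
      total (suc (t * s + i)) (suc ℓ)
        ≡⟨ total-suc (t * s + i) (suc ℓ) ⟩
      total (t * s + i) (suc ℓ) + (if X (suc (t * s + i)) then total (t * s + i) ℓ else 0)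
        ≡⟨ cong (λ x → total (t * s + i) (suc ℓ) + (if x then total (t * s + i) ℓ else 0)) membership ⟩
      total (t * s + i) (suc ℓ) + (if suc i ≡ᵇ r then total (t * s + i) ℓ else 0)
        ∎
      where
      open ≡-Reasoning
      membership : X (suc (t * s + i)) ≡ (suc i ≡ᵇ r)
      membership = trans (cong X (sym (ℕₚ.+-suc (t * s) i)))
                         (inR-block s′ r t (suc i) (s≤s z≤n) i<s (s≤s z≤n) (s≤s r′≤s′))

    letter∉X : ∀ t i ℓ → i < s → i ≢ r′ → total (t * s + suc i) (suc ℓ) ≡ total (t * s + i) (suc ℓ)
    letter∉X t i ℓ i<s i≢r′ = trans (letter t i ℓ i<s) (+-if-false (dec-false (i ≟ r′) i≢r′))

    letter∈X : ∀ t ℓ → total (t * s + r) (suc ℓ) ≡ total (t * s + r′) (suc ℓ) + total (t * s + r′) ℓ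
    letter∈X t ℓ = trans (letter t r′ ℓ (s≤s r′≤s′)) (+-if-true (dec-true (r′ ≟ r′) refl))

    total-before-r : ∀ t i ℓ → i ≤ r′ → total (t * s + i) (suc ℓ) ≡ total (t * s) (suc ℓ)
    total-before-r t zero    ℓ _    = cong (λ M → total M (suc ℓ)) (ℕₚ.+-identityʳ (t * s))
    total-before-r t (suc i) ℓ i<r′ =
      trans (letter∉X t i ℓ (ℕₚ.<-≤-trans i<r′ (ℕₚ.m≤n⇒m≤1+n r′≤s′)) (ℕₚ.<⇒≢ i<r′))
            (total-before-r t i ℓ (ℕₚ.<⇒≤ i<r′))

    total-after-r : ∀ t i ℓ → r + i ≤ s → total (t * s + (r + i)) (suc ℓ) ≡ total (t * s) (suc ℓ) + total (t * s + r′) ℓ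
    total-after-r t zero    ℓ _ = begin
      total (t * s + (r + 0)) (suc ℓ)                      ≡⟨ cong (λ x → total (t * s + x) (suc ℓ)) (ℕₚ.+-identityʳ r) ⟩
      total (t * s + r) (suc ℓ)                            ≡⟨ letter∈X t ℓ ⟩
      total (t * s + r′) (suc ℓ) + total (t * s + r′) ℓ
                                                           ≡⟨ cong (_+ total (t * s + r′) ℓ) (total-before-r t r′ ℓ ℕₚ.≤-refl) ⟩
      total (t * s) (suc ℓ) + total (t * s + r′) ℓ         ∎
      where open ≡-Reasoning
    total-after-r t (suc i) ℓ r+i<s = begin
      total (t * s + (r + suc i)) (suc ℓ)            ≡⟨ cong (λ x → total (t * s + x) (suc ℓ)) (ℕₚ.+-suc r i) ⟩
      total (t * s + suc (r + i)) (suc ℓ)            ≡⟨ letter∉X t (r + i) ℓ r+i<s′ r+i≢r′ ⟩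
      total (t * s + (r + i)) (suc ℓ)                ≡⟨ total-after-r t i ℓ (ℕₚ.<⇒≤ r+i<s′) ⟩
      total (t * s) (suc ℓ) + total (t * s + r′) ℓ   ∎
      where
      open ≡-Reasoning
      r+i<s′ : r + i < s
      r+i<s′ = subst (_≤ s) (ℕₚ.+-suc r i) r+i<s
      r+i≢r′ : r + i ≢ r′
      r+i≢r′ eq = ℕₚ.<⇒≢ (s≤s (ℕₚ.m≤m+n r′ i)) (sym eq)

    total-zero : ∀ M → total M 0 ≡ M
    total-zero zero    = refl
    total-zero (suc M) = trans (total-suc M 0) (trans (cong (_+ 1) (total-zero M)) (ℕₚ.+-comm M 1))

    block-step : ∀ t ℓ → total (suc t * s) (suc ℓ) ≡ total (t * s) (suc ℓ) + total (t * s + r′) ℓ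
    block-step t ℓ = begin
      total (s + t * s) (suc ℓ)               ≡⟨ cong (λ M → total M (suc ℓ)) (ℕₚ.+-comm s (t * s)) ⟩
      total (t * s + s) (suc ℓ)               ≡⟨ cong (λ x → total (t * s + x) (suc ℓ)) (ℕₚ.m+[n∸m]≡n r≤s) ⟨
      total (t * s + (r + (s ∸ r))) (suc ℓ)   ≡⟨ total-after-r t (s ∸ r) ℓ (ℕₚ.≤-reflexive (ℕₚ.m+[n∸m]≡n r≤s)) ⟩
      total (t * s) (suc ℓ) + total (t * s + r′) ℓ ∎
      where
      open ≡-Reasoning
      r≤s : r ≤ s
      r≤s = s≤s r′≤s′

  block-total : ∀ t ℓ → chainTotal (inR s r) (t * s) (suc ℓ) ≡ s * (t C suc (suc ℓ)) + r′ * (t C suc ℓ)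
  block-total zero    ℓ       = sym (cong₂ _+_ (ℕₚ.*-zeroʳ s) (ℕₚ.*-zeroʳ r′))
  block-total (suc t) zero    = begin
    total (suc t * s) 1                              ≡⟨ block-step t 0 ⟩
    total (t * s) 1 + total (t * s + r′) 0           ≡⟨ cong₂ _+_ (block-total t 0) (total-zero (t * s + r′)) ⟩
    s * (t C 2) + r′ * (t C 1) + (t * s + r′)        ≡⟨ cong (λ x → s * (t C 2) + r′ * x + (t * s + r′)) (nC1≡n t) ⟩
    s * (t C 2) + r′ * t + (t * s + r′)              ≡⟨ regroup s (t C 2) r′ t ⟩
    s * (t + t C 2) + r′ * suc t                     ≡⟨ cong₂ (λ x y → s * x + r′ * y) pascal (sym (nC1≡n (suc t))) ⟩
    s * (suc t C 2) + r′ * (suc t C 1)               ∎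
    where
    open ≡-Reasoning
    regroup : ∀ s c r t → s * c + r * t + (t * s + r) ≡ s * (t + c) + r * suc t
    regroup = ℕ-Solver.solve-∀
    pascal : t + t C 2 ≡ suc t C 2
    pascal = trans (cong (_+ t C 2) (sym (nC1≡n t))) (nCk+nC[k+1]≡[n+1]C[k+1] t 1)
  block-total (suc t) (suc ℓ) = begin
    total (suc t * s) (suc (suc ℓ))                  ≡⟨ block-step t (suc ℓ) ⟩
    total (t * s) (suc (suc ℓ)) + total (t * s + r′) (suc ℓ)
      ≡⟨ cong (_+_ (total (t * s) (suc (suc ℓ)))) (total-before-r t r′ ℓ ℕₚ.≤-refl) ⟩
    total (t * s) (suc (suc ℓ)) + total (t * s) (suc ℓ)
                                                     ≡⟨ cong₂ _+_ (block-total t (suc ℓ)) (block-total t ℓ) ⟩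
    s * c₃ + r′ * c₂ + (s * c₂ + r′ * c₁)            ≡⟨ regroup s r′ c₁ c₂ c₃ ⟩
    s * (c₂ + c₃) + r′ * (c₁ + c₂)
      ≡⟨ cong₂ (λ x y → s * x + r′ * y) (nCk+nC[k+1]≡[n+1]C[k+1] t (suc (suc ℓ))) (nCk+nC[k+1]≡[n+1]C[k+1] t (suc ℓ)) ⟩
    s * (suc t C suc (suc (suc ℓ))) + r′ * (suc t C suc (suc ℓ)) ∎
    where
    open ≡-Reasoning
    c₁ = t C suc ℓ
    c₂ = t C suc (suc ℓ)
    c₃ = t C suc (suc (suc ℓ))
    regroup : ∀ s r c₁ c₂ c₃ → s * c₃ + r * c₂ + (s * c₂ + r * c₁) ≡ s * (c₂ + c₃) + r * (c₁ + c₂)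
    regroup = ℕ-Solver.solve-∀

  shift-chainTotal≗chainSeries : ∀ k → shift (λ ℓ → + chainTotal (inR s r) (s * k) ℓ) ≗ chainSeries s k r′
  shift-chainTotal≗chainSeries k zero          = sym (chainSeries-zero s k r′)
  shift-chainTotal≗chainSeries k (suc zero)    = trans (cong +_ (total-zero (s * k))) (sym (chainSeries-one s k r′))
  shift-chainTotal≗chainSeries k (suc (suc ℓ)) = trans (cong +_ blocks) (sym (chainSeries-suc-suc s k r′ ℓ))
    where
    blocks : chainTotal (inR s r) (s * k) (suc ℓ) ≡ s * (k C suc (suc ℓ)) + r′ * (k C suc ℓ)
    blocks = trans (cong (λ M → chainTotal (inR s r) M (suc ℓ)) (ℕₚ.*-comm s k)) (block-total k ℓ)

sgn≡-1^ : ∀ n → sgn n ≡ -1ℤ ℤ.^ n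
sgn≡-1^ zero          = refl
sgn≡-1^ (suc zero)    = refl
sgn≡-1^ (suc (suc n)) = begin
  sgn (2 + n)     ≡⟨ cong (λ m → if m % 2 ≡ᵇ 0 then + 1 else - + 1) (ℕₚ.+-comm 2 n) ⟩
  sgn (n + 2)     ≡⟨ cong (λ m → if m ≡ᵇ 0 then + 1 else - + 1) ([m+kn]%n≡m%n n 1 2) ⟩
  sgn n           ≡⟨ sgn≡-1^ n ⟩
  -1ℤ ℤ.^ n       ≡⟨ -1^-suc-suc n ⟨
  -1ℤ ℤ.^ (2 + n) ∎
  where open ≡-Reasoning

formula-summand : ∀ (σ₁ σ₂ : ℤ) (a b c d e f : ℕ) →
  + (a * b * c) ℤ.* (σ₁ ℤ.* + d ℤ.* + e) ℤ.* (σ₂ ℤ.* + f) ≡ (σ₂ ℤ.* σ₁) ℤ.* + (a * b * c * d * e * f)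
formula-summand σ₁ σ₂ a b c d e f = begin
  + (a * b * c) ℤ.* (σ₁ ℤ.* + d ℤ.* + e) ℤ.* (σ₂ ℤ.* + f)
    ≡⟨ cong (λ x → x ℤ.* (σ₁ ℤ.* + d ℤ.* + e) ℤ.* (σ₂ ℤ.* + f)) (+-*3 a b c) ⟩
  + a ℤ.* + b ℤ.* + c ℤ.* (σ₁ ℤ.* + d ℤ.* + e) ℤ.* (σ₂ ℤ.* + f)
    ≡⟨ rearrange σ₁ σ₂ (+ a) (+ b) (+ c) (+ d) (+ e) (+ f) ⟩
  (σ₂ ℤ.* σ₁) ℤ.* (+ a ℤ.* + b ℤ.* + c ℤ.* + d ℤ.* + e ℤ.* + f)
    ≡⟨ cong (σ₂ ℤ.* σ₁ ℤ.*_) +-*6 ⟨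
  (σ₂ ℤ.* σ₁) ℤ.* + (a * b * c * d * e * f)
    ∎
  where
  open ≡-Reasoning
  +-*3 : ∀ a b c → + (a * b * c) ≡ + a ℤ.* + b ℤ.* + c
  +-*3 a b c = trans (ℤₚ.pos-* (a * b) c) (cong (ℤ._* + c) (ℤₚ.pos-* a b))
  +-*6 : + (a * b * c * d * e * f) ≡ + a ℤ.* + b ℤ.* + c ℤ.* + d ℤ.* + e ℤ.* + f
  +-*6 = trans (ℤₚ.pos-* (a * b * c * d * e) f) (cong (ℤ._* + f)
         (trans (ℤₚ.pos-* (a * b * c * d) e) (cong (ℤ._* + e)
         (trans (ℤₚ.pos-* (a * b * c) d) (cong (ℤ._* + d) (+-*3 a b c))))))
  rearrange : ∀ σ₁ σ₂ a b c d e f →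
    a ℤ.* b ℤ.* c ℤ.* (σ₁ ℤ.* d ℤ.* e) ℤ.* (σ₂ ℤ.* f)
    ≡ (σ₂ ℤ.* σ₁) ℤ.* (a ℤ.* b ℤ.* c ℤ.* d ℤ.* e ℤ.* f)
  rearrange = ℤ-Solver.solve-∀

sgn-split : ∀ n p j i → j ≤ n → -1ℤ ℤ.^ (n ∸ j + p) ℤ.* -1ℤ ℤ.^ (j + i) ≡ sgn (n + p + i)
sgn-split n p j i j≤n = begin
  -1ℤ ℤ.^ (n ∸ j + p) ℤ.* -1ℤ ℤ.^ (j + i)   ≡⟨ ℤₚ.^-distribˡ-+-* -1ℤ (n ∸ j + p) (j + i) ⟨
  -1ℤ ℤ.^ (n ∸ j + p + (j + i))            ≡⟨ cong (-1ℤ ℤ.^_) (shuffle (n ∸ j) p j i) ⟩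
  -1ℤ ℤ.^ (n ∸ j + j + p + i)              ≡⟨ cong (λ m → -1ℤ ℤ.^ (m + p + i)) (ℕₚ.m∸n+n≡m j≤n) ⟩
  -1ℤ ℤ.^ (n + p + i)                      ≡⟨ sgn≡-1^ (n + p + i) ⟨
  sgn (n + p + i)                          ∎
  where
  open ≡-Reasoning
  shuffle : ∀ m p j i → m + p + (j + i) ≡ m + j + p + i
  shuffle = ℕ-Solver.solve-∀

pow-chainSeries-*-signedBinom : ∀ s k r′ n p j → j ≤ n →
  pow (chainSeries s k r′) j n ℤ.* signedBinom (n ∸ j) p ≡
  sumTo j (λ i₁ → sumTo j (λ i₂ → sgn (n + p + i₂) ℤ.*
    + (s ^ (j ∸ i₁) * r′ ^ i₁ * (j C i₁) * (j C i₂) * ((k * i₂) C (n ∸ i₁)) * ((n ∸ j) C p))))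
pow-chainSeries-*-signedBinom s k r′ n p j j≤n = begin
  pow (chainSeries s k r′) j n ℤ.* σ
    ≡⟨ cong (ℤ._* σ) (pow-chainSeries s k r′ j n) ⟩
  sumTo n (λ i → a i ℤ.* b i) ℤ.* σ
    ≡⟨ cong (ℤ._* σ) (sumTo-extend _ j≤n a≡0) ⟩
  sumTo j (λ i → a i ℤ.* b i) ℤ.* σ
    ≡⟨ *-distribʳ-sumTo j σ _ ⟩
  sumTo j (λ i₁ → a i₁ ℤ.* b i₁ ℤ.* σ)
    ≡⟨ sumTo-cong j (λ i₁ _ → trans (cong (ℤ._* σ) (*-distribˡ-sumTo j (a i₁) _)) (*-distribʳ-sumTo j σ _)) ⟩
  sumTo j (λ i₁ → sumTo j (λ i₂ → a i₁ ℤ.* (signedBinom j i₂ ℤ.* + ((k * i₂) C (n ∸ i₁))) ℤ.* σ))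
    ≡⟨ sumTo-cong j (λ i₁ _ → sumTo-cong j (λ i₂ _ → term i₁ i₂)) ⟩
  sumTo j (λ i₁ → sumTo j (λ i₂ → sgn (n + p + i₂) ℤ.* + (c i₁ i₂)))
    ∎
  where
  open ≡-Reasoning
  σ = signedBinom (n ∸ j) p
  a : ℕ → ℤ
  a i = + (s ^ (j ∸ i) * r′ ^ i * (j C i))
  b : ℕ → ℤ
  b i = sumTo j (λ i₂ → signedBinom j i₂ ℤ.* + ((k * i₂) C (n ∸ i)))
  c : ℕ → ℕ → ℕ
  c i₁ i₂ = s ^ (j ∸ i₁) * r′ ^ i₁ * (j C i₁) * (j C i₂) * ((k * i₂) C (n ∸ i₁)) * ((n ∸ j) C p)
  a≡0 : ∀ i → j < i → a i ℤ.* b i ≡ + 0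
  a≡0 i j<i = begin
    + (s ^ (j ∸ i) * r′ ^ i * (j C i)) ℤ.* b i   ≡⟨ cong (λ x → + (s ^ (j ∸ i) * r′ ^ i * x) ℤ.* b i) (k>n⇒nCk≡0 j<i) ⟩
    + (s ^ (j ∸ i) * r′ ^ i * 0) ℤ.* b i         ≡⟨ cong (λ x → + x ℤ.* b i) (ℕₚ.*-zeroʳ (s ^ (j ∸ i) * r′ ^ i)) ⟩
    + 0 ℤ.* b i                                  ≡⟨ ℤₚ.*-zeroˡ (b i) ⟩
    + 0                                          ∎
  term : ∀ i₁ i₂ → a i₁ ℤ.* (signedBinom j i₂ ℤ.* + ((k * i₂) C (n ∸ i₁))) ℤ.* σ ≡ sgn (n + p + i₂) ℤ.* + (c i₁ i₂)
  term i₁ i₂ = trans (formula-summand (-1ℤ ℤ.^ (j + i₂)) (-1ℤ ℤ.^ (n ∸ j + p))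
                                      (s ^ (j ∸ i₁)) (r′ ^ i₁) (j C i₁) (j C i₂) ((k * i₂) C (n ∸ i₁)) ((n ∸ j) C p))
                     (cong (ℤ._* + (c i₁ i₂)) (sgn-split n p j i₂ j≤n))

chainSeries-formula : ∀ s k r′ n p →
  sumTo n (λ j → pow (chainSeries s k r′) j n ℤ.* signedBinom (n ∸ j) p) ≡ formula s k (suc r′) n p
chainSeries-formula s k r′ n p = sumTo-cong n (pow-chainSeries-*-signedBinom s k r′ n p)

-- Complementation

<ᵇ-complement : ∀ N a b → b ≤ N → (a <ᵇ b) ≡ (suc N ∸ b <ᵇ suc N ∸ a)
<ᵇ-complement N a b b≤N =
  does-≡ (a <? b)
         (map′ ℕₚ.∸-cancelʳ-< (λ a<b → ℕₚ.∸-monoʳ-< a<b (ℕₚ.m≤n⇒m≤1+n b≤N)) (suc N ∸ b <? suc N ∸ a))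

block-complement : ∀ s k t i → t < k → i ≤ s → suc (s * k) ∸ (t * s + i) ≡ (k ∸ suc t) * s + (suc s ∸ i)
block-complement s k t i t<k i≤s =
  trans (cong (_∸ (t * s + i)) (sym total)) (ℕₚ.m+n∸n≡m ((k ∸ suc t) * s + (suc s ∸ i)) (t * s + i))
  where
  open ≡-Reasoning
  u = k ∸ suc t
  d = suc s ∸ i
  shuffle : ∀ u s d t i → u * s + d + (t * s + i) ≡ u * s + t * s + (d + i)
  shuffle = ℕ-Solver.solve-∀
  collect : ∀ u s t → u * s + t * s + suc s ≡ suc (s * (suc t + u))
  collect = ℕ-Solver.solve-∀
  total : u * s + d + (t * s + i) ≡ suc (s * k)
  total = begin
    u * s + d + (t * s + i)    ≡⟨ shuffle u s d t i ⟩
    u * s + t * s + (d + i)    ≡⟨ cong (_+_ (u * s + t * s)) (ℕₚ.m∸n+n≡m (ℕₚ.m≤n⇒m≤1+n i≤s)) ⟩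
    u * s + t * s + suc s      ≡⟨ collect u s t ⟩
    suc (s * (suc t + u))      ≡⟨ cong (λ x → suc (s * x)) (ℕₚ.m+[n∸m]≡n t<k) ⟩
    suc (s * k)                ∎

reflect-bounds : ∀ {s x} → 1 ≤ x → x ≤ s → 1 ≤ suc s ∸ x × suc s ∸ x ≤ s
reflect-bounds {s} {x} 1≤x x≤s = subst (1 ≤_) (sym (ℕₚ.+-∸-assoc 1 x≤s)) (s≤s z≤n) , ℕₚ.∸-monoʳ-≤ {1} {x} (suc s) 1≤x

reflect-swap : ∀ {m x y} → y ≤ m → x ≡ m ∸ y → m ∸ x ≡ y
reflect-swap {m} y≤m refl = ℕₚ.m∸[m∸n]≡n y≤m

complement-in-block : ∀ s′ k r t i → 1 ≤ r → r ≤ suc s′ → 1 ≤ i → i ≤ suc s′ → t < k →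
  inR (suc s′) (suc s′ + 1 ∸ r) (t * suc s′ + i) ≡ inR (suc s′) r (suc (suc s′ * k) ∸ (t * suc s′ + i))
complement-in-block s′ k r t i 1≤r r≤s 1≤i i≤s t<k = begin
  inR s (s + 1 ∸ r) (t * s + i)             ≡⟨ cong (λ x → inR s (x ∸ r) (t * s + i)) (ℕₚ.+-comm s 1) ⟩
  inR s (suc s ∸ r) (t * s + i)             ≡⟨ inR-block s′ (suc s ∸ r) t i 1≤i i≤s 1≤r̄ r̄≤s ⟩
  (i ≡ᵇ suc s ∸ r)                          ≡⟨ does-≡ (i ≟ suc s ∸ r) (map′ ⇐ ⇒ (suc s ∸ i ≟ r)) ⟩
  (suc s ∸ i ≡ᵇ r)                          ≡⟨ inR-block s′ r (k ∸ suc t) (suc s ∸ i) 1≤ī ī≤s 1≤r r≤s ⟨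
  inR s r ((k ∸ suc t) * s + (suc s ∸ i))   ≡⟨ cong (inR s r) (block-complement s k t i t<k i≤s) ⟨
  inR s r (suc (s * k) ∸ (t * s + i))       ∎
  where
  open ≡-Reasoning
  s = suc s′
  1≤r̄ = proj₁ (reflect-bounds 1≤r r≤s)
  r̄≤s = proj₂ (reflect-bounds 1≤r r≤s)
  1≤ī = proj₁ (reflect-bounds 1≤i i≤s)
  ī≤s = proj₂ (reflect-bounds 1≤i i≤s)
  ⇒ : i ≡ suc s ∸ r → suc s ∸ i ≡ r
  ⇒ = reflect-swap (ℕₚ.m≤n⇒m≤1+n r≤s)
  ⇐ : suc s ∸ i ≡ r → i ≡ suc s ∸ r
  ⇐ ī≡r = sym (reflect-swap (ℕₚ.m≤n⇒m≤1+n i≤s) (sym ī≡r))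

inR-complement : ∀ s′ k r → 1 ≤ r → r ≤ suc s′ → ∀ a → 1 ≤ a → a ≤ suc s′ * k →
  inR (suc s′) (suc s′ + 1 ∸ r) a ≡ inR (suc s′) r (suc (suc s′ * k) ∸ a)
inR-complement s′ k r 1≤r r≤s (suc a′) _ a≤N =
  subst (λ x → inR s (s + 1 ∸ r) x ≡ inR s r (suc (s * k) ∸ x)) (sym a≡)
        (complement-in-block s′ k r (a′ / s) (suc (a′ % s)) 1≤r r≤s (s≤s z≤n) (m%n<n a′ s) block<k)
  where
  s = suc s′
  a≡ : suc a′ ≡ a′ / s * s + suc (a′ % s)
  a≡ = trans (cong suc (m≡m%n+[m/n]*n a′ s)) (ℕₚ.+-comm (suc (a′ % s)) (a′ / s * s))
  block<k : a′ / s < k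
  block<k = ℕₚ.*-cancelʳ-< s (a′ / s) k
    (ℕₚ.<-≤-trans (s≤s (m/n*n≤m a′ s)) (subst (suc a′ ≤_) (ℕₚ.*-comm s k) a≤N))

adjacencies-map : ∀ {P : ℕ → Set} (κ : ℕ → ℕ) (e e′ : ℕ → ℕ → Bool) →
  (∀ {a b} → P a → P b → e′ a b ≡ e (κ a) (κ b)) →
  ∀ π → All P π → adjacencies e′ π ≡ adjacencies e (map κ π)
adjacencies-map κ e e′ e′≡e []          _                = refl
adjacencies-map κ e e′ e′≡e (a ∷ [])    _                = refl
adjacencies-map κ e e′ e′≡e (a ∷ b ∷ π) (pa ∷ pb ∷ ps) =
  cong₂ (λ x y → (if x then 1 else 0) + y) (e′≡e pa pb) (adjacencies-map κ e e′ e′≡e (b ∷ π) (pb ∷ ps))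

sumL-words-complement : ∀ N n (f g : List ℕ → ℤ) →
  (∀ π → All (λ a → 1 ≤ a × a ≤ N) π → f (map (λ a → suc N ∸ a) π) ≡ g π) →
  sumL (words N n) f ≡ sumL (words N n) g
sumL-words-complement N zero    f g f≡g = cong (ℤ._+ + 0) (f≡g [] [])
sumL-words-complement N (suc n) f g f≡g = begin
  sumL (words N (suc n)) f                                              ≡⟨ sumL-words-suc N n f ⟩
  sumL (range1 N) (λ a → sumL (words N n) (λ w → f (a ∷ w)))            ≡⟨ sumL-range-reverse N _ ⟩
  sumL (range1 N) (λ a → sumL (words N n) (λ w → f (suc N ∸ a ∷ w)))    ≡⟨ sumL-range-cong N first-letter ⟩
  sumL (range1 N) (λ a → sumL (words N n) (λ w → g (a ∷ w)))            ≡⟨ sumL-words-suc N n g ⟨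
  sumL (words N (suc n)) g                                              ∎
  where
  open ≡-Reasoning
  first-letter : ∀ a → 1 ≤ a → a ≤ N →
    sumL (words N n) (λ w → f (suc N ∸ a ∷ w)) ≡ sumL (words N n) (λ w → g (a ∷ w))
  first-letter a 1≤a a≤N = sumL-words-complement N n _ _ (λ π π∈ → f≡g (a ∷ π) ((1≤a , a≤N) ∷ π∈))

risR≡desR-complement : ∀ s′ k r → 1 ≤ r → r ≤ suc s′ → ∀ π → All (λ a → 1 ≤ a × a ≤ suc s′ * k) π →
  risR (suc s′) (suc s′ + 1 ∸ r) π ≡ desR (suc s′) r (map (λ a → suc (suc s′ * k) ∸ a) π)
risR≡desR-complement s′ k r 1≤r r≤s π π∈ = begin
  risR s (s + 1 ∸ r) π                                    ≡⟨ risR≡adjacencies s (s + 1 ∸ r) π ⟩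
  adjacencies (ascentAt (inR s (s + 1 ∸ r))) π            ≡⟨ adjacencies-map κ _ _ step π π∈ ⟩
  adjacencies (descentAt (inR s r)) (map κ π)             ≡⟨ desR≡adjacencies s r (map κ π) ⟨
  desR s r (map κ π)                                      ∎
  where
  open ≡-Reasoning
  s = suc s′
  κ = λ a → suc (s * k) ∸ a
  step : ∀ {a b} → 1 ≤ a × a ≤ s * k → 1 ≤ b × b ≤ s * k →
    ascentAt (inR s (s + 1 ∸ r)) a b ≡ descentAt (inR s r) (κ a) (κ b)
  step {a} {b} (1≤a , a≤N) (_ , b≤N) =
    cong₂ _∧_ (inR-complement s′ k r 1≤r r≤s a 1≤a a≤N) (<ᵇ-complement (s * k) a b b≤N)

ascentCount≡descentCount : ∀ s′ k r n p → 1 ≤ r → r ≤ suc s′ →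
  countWords (risR (suc s′) (suc s′ + 1 ∸ r)) (suc s′ * k) n p ≡ countWords (desR (suc s′) r) (suc s′ * k) n p
ascentCount≡descentCount s′ k r n p 1≤r r≤s = ℤₚ.+-injective (begin
  + countWords (risR s (s + 1 ∸ r)) N n p                  ≡⟨ countWords≡coefficient (risR s (s + 1 ∸ r)) N n p ⟩
  sumL (words N n) (λ π → monomial (risR s (s + 1 ∸ r) π) p) ≡⟨ sumL-words-complement N n _ _ des∘κ≡ris ⟨
  sumL (words N n) (λ π → monomial (desR s r π) p)         ≡⟨ countWords≡coefficient (desR s r) N n p ⟨
  + countWords (desR s r) N n p                            ∎)
  where
  open ≡-Reasoning
  s = suc s′
  N = s * k
  des∘κ≡ris : ∀ π → All (λ a → 1 ≤ a × a ≤ N) π →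
    monomial (desR s r (map (λ a → suc N ∸ a) π)) p ≡ monomial (risR s (s + 1 ∸ r) π) p
  des∘κ≡ris π π∈ = cong (λ d → monomial d p) (sym (risR≡desR-complement s′ k r 1≤r r≤s π π∈))

descentCount≡formula : ∀ s′ k r′ n p → r′ ≤ s′ →
  + countWords (desR (suc s′) (suc r′)) (suc s′ * k) n p ≡ formula (suc s′) k (suc r′) n p
descentCount≡formula s′ k r′ n p r′≤s′ = begin
  + countWords (desR s r) N n p
    ≡⟨ countWords≡coefficient (desR s r) N n p ⟩
  sumL (words N n) (λ π → monomial (desR s r π) p)
    ≡⟨ sumL-cong (words N n) (λ π → cong (λ d → monomial d p) (desR≡adjacencies s r π)) ⟩
  P n p
    ≡⟨ P≗closedForm n p ⟩
  closedForm n p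
    ≡⟨ closedForm-coefficient n p ⟩
  sumTo n (λ j → pow (shift g) j n ℤ.* signedBinom (n ∸ j) p)
    ≡⟨ sumTo-cong n (λ j _ → cong (ℤ._* signedBinom (n ∸ j) p) (pow-cong j (shift-chainTotal≗chainSeries k) n)) ⟩
  sumTo n (λ j → pow (chainSeries s k r′) j n ℤ.* signedBinom (n ∸ j) p)
    ≡⟨ chainSeries-formula s k r′ n p ⟩
  formula s k r n p
    ∎
  where
  open ≡-Reasoning
  s = suc s′
  r = suc r′
  N = s * k
  g : Series
  g ℓ = + chainTotal (inR s r) N ℓ
  open DescentChains N (inR s r)
  open RecurrenceSolution g P P-zero P-recurrence
  open ResidueChains s′ r′ r′≤s′

theorem5p1 : (s k r n p : ℕ) → 2 ≤ s → 1 ≤ k → 1 ≤ r → r ≤ s →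
    (+ countWords (desR s r) (s * k) n p ≡ formula s k r n p)
    × (+ countWords (risR s (s + 1 ∸ r)) (s * k) n p ≡ formula s k r n p)
theorem5p1 (suc s′) k (suc r′) n p _ _ 1≤r r≤s@(s≤s r′≤s′) =
  descentCount≡formula s′ k r′ n p r′≤s′ ,
  trans (cong +_ (ascentCount≡descentCount s′ k (suc r′) n p 1≤r r≤s))
        (descentCount≡formula s′ k r′ n p r′≤s′)
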